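{- Let $n\ge4$ and let $G$ be a simple graph on $[n]$ with $m$ edges. Let $t(G)$ be the number of triangles, $s(G)=\sum_v\binom{d_v}{3}$ the number of three-edge stars $K_{1,3}$, $r(G)$ the number of three-edge paths $P_4$, $q(G)$ the number of three-edge subsets of $E(G)$ whose union is a disjoint union of a two-edge path and an edge, and $d_3(G)$ the number of three-edge subsets consisting of three pairwise disjoint edges. Put $$c_2=\tfrac{(n-3)(n-4)}2,\quad c_4=\tfrac{n^2-11n+28}2,\quad c_{32}=\tfrac{n^2-13n+42}2,\quad c_{222}=\tfrac{n^2-15n+60}2.$$ Then $$M_3^{(2)}(G)=c_2\bigl(m+3m(m-1)+6t(G)\bigr)+6c_4\bigl(s(G)+r(G)\bigr)+6c_{32}q(G)+6c_{222}d_3(G),$$ equivalently $$M_3^{(2)}(G)=c_2\bigl(m+3m(m-1)+6t(G)\bigr)+6c_{222}\binom m3+6(c_4-c_{222})(s(G)+r(G))+6(c_{32}-c_{222})q(G)-6c_{222}t(G).$$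
   Context: $d_v$ is the degree of $v$. $M_3^{(2)}(G)=\operatorname{tr}\big((X_G|_{W_n})^3\big)$, where $V_n$ is the complex vector space with basis $e_{ij}$ indexed by unordered pairs $\{i,j\}\subset[n]$ with $S_n$ acting by $\sigma e_{ij}=e_{\sigma(i)\sigma(j)}$, $W_n=\{z\in V_n:\sum_{j\ne i}z_{ij}=0\ \forall i\}$, and $X_G=\sum_{ij\in E(G)}(ij)\in\mathbb C[S_n]$ acting on $W_n$. -}

module Defs where

open import Data.Nat as ℕ using (ℕ; _≡ᵇ_)
open import Data.Nat.Combinatorics using (_C_)
open import Data.Integer as ℤ using (ℤ; +_)
open import Data.Fin using (Fin; toℕ; _<_)
open import Data.Fin.Properties using (_<?_; _≟_)
open import Data.Bool using (Bool; true; false; _∨_; _∧_; not; if_then_else_)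
open import Data.List using (List; []; _∷_; map; _++_; concatMap; foldr; filter; allFin)
open import Data.Product using (_×_; _,_)
open import Relation.Nullary using (yes; no)
open import Relation.Nullary.Decidable using (⌊_⌋)
open import Relation.Binary.PropositionalEquality using (_≡_)
open import Data.Rational as ℚ using (ℚ; 0ℚ; 1ℚ)

record UPair (n : ℕ) : Set where
  constructor upair
  field
    lo : Fin n
    hi : Fin n
    lt : lo < hi
open UPair public

private
  mkU : ∀ {n} → Fin n → Fin n → List (UPair n)
  mkU i j with i <? j
  ... | yes p = upair i j p ∷ []
  ... | no _  = []

-- Duplicate-free enumeration of all unordered pairs: the basis e_ij of V_n.
allUPairs : (n : ℕ) → List (UPair n)
allUPairs n = concatMap (λ i → concatMap (λ j → mkU i j) (allFin n)) (allFin n)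

_∈ᵖ_ : ∀ {n} → Fin n → UPair n → Bool
v ∈ᵖ p = ⌊ lo p ≟ v ⌋ ∨ ⌊ hi p ≟ v ⌋

count : ∀ {A : Set} → (A → Bool) → List A → ℕ
count f []       = 0
count f (x ∷ xs) = (if f x then 1 else 0) ℕ.+ count f xs

Graph : ℕ → Set
Graph n = UPair n → Bool

edges : ∀ {n} → Graph n → List (UPair n)
edges {n} G = filter (λ p → Data.Bool._≟_ (G p) true) (allUPairs n)
  where import Data.Bool

numEdges : ∀ {n} → Graph n → ℕ
numEdges G = count (λ _ → true) (edges G)

degree : ∀ {n} → Graph n → Fin n → ℕ
degree G v = count (v ∈ᵖ_) (edges G)

-- 3-element subsets of a (duplicate-free) list
pairsL : ∀ {A : Set} → List A → List (A × A)
pairsL []       = []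
pairsL (x ∷ xs) = map (λ y → x , y) xs ++ pairsL xs

triplesL : ∀ {A : Set} → List A → List (A × A × A)
triplesL []       = []
triplesL (x ∷ xs) = map (λ { (y , z) → x , y , z }) (pairsL xs) ++ triplesL xs

unionSize : ∀ {n} → UPair n × UPair n × UPair n → ℕ
unionSize {n} (a , b , c) = count (λ v → (v ∈ᵖ a) ∨ (v ∈ᵖ b) ∨ (v ∈ᵖ c)) (allFin n)

commonVertex : ∀ {n} → UPair n × UPair n × UPair n → Bool
commonVertex {n} (a , b , c) = 0 ℕ.<ᵇ count (λ v → (v ∈ᵖ a) ∧ (v ∈ᵖ b) ∧ (v ∈ᵖ c)) (allFin n)

-- t(G): triangles = 3-edge subsets whose union is a K3 (3 vertices)
triangles : ∀ {n} → Graph n → ℕ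
triangles G = count (λ T → unionSize T ≡ᵇ 3) (triplesL (edges G))

stars : ∀ {n} → Graph n → ℕ
stars {n} G = foldr ℕ._+_ 0 (map (λ v → degree G v C 3) (allFin n))

-- r(G): 3-edge subsets forming a P4 (4 vertices, no vertex common to all three)
paths3 : ∀ {n} → Graph n → ℕ
paths3 G = count (λ T → (unionSize T ≡ᵇ 4) ∧ not (commonVertex T)) (triplesL (edges G))

-- q(G): 3-edge subsets forming P3 ⊔ K2 (5 vertices)
pathPlusEdge : ∀ {n} → Graph n → ℕ
pathPlusEdge G = count (λ T → unionSize T ≡ᵇ 5) (triplesL (edges G))

-- d3(G): 3 pairwise disjoint edges (6 vertices)
matchings3 : ∀ {n} → Graph n → ℕ
matchings3 G = count (λ T → unionSize T ≡ᵇ 6) (triplesL (edges G))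

Vec : ℕ → Set
Vec n = UPair n → ℚ

Mat : ℕ → Set
Mat n = UPair n → UPair n → ℚ

sumℚ : List ℚ → ℚ
sumℚ = foldr ℚ._+_ 0ℚ

_·_ : ∀ {n} → Mat n → Mat n → Mat n
_·_ {n} A B p q = sumℚ (map (λ r → A p r ℚ.* B r q) (allUPairs n))

apply : ∀ {n} → Mat n → Vec n → Vec n
apply {n} A z p = sumℚ (map (λ q → A p q ℚ.* z q) (allUPairs n))

trace : ∀ {n} → Mat n → ℚ
trace {n} A = sumℚ (map (λ p → A p p) (allUPairs n))

transposeM : ∀ {n} → Mat n → Mat n
transposeM A p q = A q p

InW : ∀ {n} → Vec n → Set
InW {n} z = (i : Fin n) →
  sumℚ (map (λ p → if i ∈ᵖ p then z p else 0ℚ) (allUPairs n)) ≡ 0ℚ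

IsOrthProjW : ∀ {n} → Mat n → Set
IsOrthProjW {n} P =
  ((z : Vec n) → InW (apply P z)) ×
  ((z : Vec n) → InW z → (p : UPair n) → apply P z p ≡ z p) ×
  ((p q : UPair n) → P p q ≡ P q p)

swap : ∀ {n} → Fin n → Fin n → Fin n → Fin n
swap a b x = if ⌊ x ≟ a ⌋ then b else (if ⌊ x ≟ b ⌋ then a else x)

sends : ∀ {n} → (Fin n → Fin n) → UPair n → UPair n → Bool
sends σ q p =
  (⌊ σ (lo q) ≟ lo p ⌋ ∧ ⌊ σ (hi q) ≟ hi p ⌋) ∨
  (⌊ σ (lo q) ≟ hi p ⌋ ∧ ⌊ σ (hi q) ≟ lo p ⌋)

-- matrix of X_G = Σ_{ab ∈ E(G)} (a b) acting on V_n:  X e_q = Σ_p X[p][q] e_p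
XG : ∀ {n} → Graph n → Mat n
XG G p q = (+ count (λ e → sends (swap (lo e) (hi e)) q p) (edges G)) ℚ./ 1

-- M_3^{(2)}(G) = tr((X_G|_{W_n})^3), computed as tr(P X_G^3) with P the
-- orthogonal projection onto the X_G-invariant subspace W_n.
M3 : ∀ {n} → Graph n → Mat n → ℚ
M3 G P = trace (P · (XG G · (XG G · XG G)))

ℕ→ℚ : ℕ → ℚ
ℕ→ℚ k = (+ k) ℚ./ 1

c2 c4 c32 c222 : ℕ → ℚ
c2   n = ((+ n ℤ.- + 3) ℤ.* (+ n ℤ.- + 4)) ℚ./ 2
c4   n = ((+ n ℤ.* + n) ℤ.- (+ 11 ℤ.* + n) ℤ.+ + 28) ℚ./ 2
c32  n = ((+ n ℤ.* + n) ℤ.- (+ 13 ℤ.* + n) ℤ.+ + 42) ℚ./ 2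
c222 n = ((+ n ℤ.* + n) ℤ.- (+ 15 ℤ.* + n) ℤ.+ + 60) ℚ./ 2

firstTerm : ∀ {n} → Graph n → ℚ
firstTerm {n} G =
  c2 n ℚ.* (ℕ→ℚ m ℚ.+ ℕ→ℚ 3 ℚ.* ℕ→ℚ m ℚ.* (ℕ→ℚ m ℚ.- 1ℚ) ℚ.+ ℕ→ℚ 6 ℚ.* ℕ→ℚ (triangles G))
  where
    m = numEdges G

rhs1 : ∀ {n} → Graph n → ℚ
rhs1 {n} G =
  firstTerm G
  ℚ.+ ℕ→ℚ 6 ℚ.* c4 n ℚ.* ℕ→ℚ (stars G ℕ.+ paths3 G)
  ℚ.+ ℕ→ℚ 6 ℚ.* c32 n ℚ.* ℕ→ℚ (pathPlusEdge G)
  ℚ.+ ℕ→ℚ 6 ℚ.* c222 n ℚ.* ℕ→ℚ (matchings3 G)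

rhs2 : ∀ {n} → Graph n → ℚ
rhs2 {n} G =
  firstTerm G
  ℚ.+ ℕ→ℚ 6 ℚ.* c222 n ℚ.* ℕ→ℚ (numEdges G C 3)
  ℚ.+ ℕ→ℚ 6 ℚ.* (c4 n ℚ.- c222 n) ℚ.* ℕ→ℚ (stars G ℕ.+ paths3 G)
  ℚ.+ ℕ→ℚ 6 ℚ.* (c32 n ℚ.- c222 n) ℚ.* ℕ→ℚ (pathPlusEdge G)
  ℚ.- ℕ→ℚ 6 ℚ.* c222 n ℚ.* ℕ→ℚ (triangles G)

-- The orthogonal projection onto W_n is unique, hence equal to the explicit matrix
-- P₀ = I − ∂ᵀ(∂∂ᵀ)⁻¹∂ built from the incidence map ∂ : V_n → ℚⁿ. Expanding X_G³ over ordered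
-- triples of edges gives tr(P₀ X_G³) = Σ χ(τ_{e₁} τ_{e₂} τ_{e₃}), where for a map σ of the vertices
-- χ(σ) = tr(P₀ σ) = (F² + F₂ − 4F)/2 with F and F₂ the numbers of fixed points of σ and σ².
-- Both numbers depend only on which of the six endpoints of the three edges coincide, and every
-- coincidence pattern is checked by computation. Finally the ordered triples split into those
-- repeating an edge and the six orderings of each 3-edge subset, classified by the number of
-- vertices it covers (3: triangle, 4: star or path, 5: path and edge, 6: matching).

module Submission where

open import Defs
open import Data.Nat as ℕ using (ℕ; zero; suc; _≤_; z≤n; s≤s; _≡ᵇ_; _<ᵇ_)
import Data.Nat.Properties as ℕ
open import Data.Nat.Coprimality using (1-coprimeTo)
import Data.Nat.Coprimality as Coprimality
open import Data.Nat.Combinatorics using (_C_; nC1≡n; nCk+nC[k+1]≡[n+1]C[k+1])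
open import Data.Integer as ℤ using (ℤ)
import Data.Integer.Properties as ℤ
open import Data.Rational as ℚ using (ℚ; 0ℚ; 1ℚ; _+_; _*_; _-_; ½)
import Data.Rational.Properties as ℚ
open import Data.Fin as Fin using (Fin; zero; suc; _<_; #_; toℕ)
open import Data.Fin.Properties as Fin using (_≟_; _<?_; all?)
open import Data.Bool as Bool using (Bool; true; false; _∧_; _∨_; not; T; if_then_else_)
open import Data.Bool.Properties using (∨-idem; ∨-comm; ∨-assoc; ∨-identityʳ; ∧-comm; ∧-idem; ∧-zeroʳ; if-float)
open import Data.Maybe as Maybe using (Maybe; just; nothing; fromMaybe; is-just; to-witness-T)
open import Data.Empty using (⊥; ⊥-elim)
open import Data.Product using (∃; ∃₂; _×_; _,_; proj₁; proj₂; uncurry)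
open import Data.List using (List; []; _∷_; map; _++_; concatMap; foldr; length; allFin)
open import Data.List.Properties using (map-tabulate; length-tabulate)
open import Data.List.Relation.Unary.All as All using (All; []; _∷_)
import Data.List.Relation.Unary.All.Properties as All
open import Data.List.Relation.Unary.AllPairs using (AllPairs; []; _∷_)
import Data.List.Relation.Unary.AllPairs.Properties as AllPairs
open import Data.Vec using (_∷_; []; lookup)
open import Function using (id; _$_)
open import Relation.Binary.Definitions using (tri<; tri≈; tri>)
open import Relation.Binary.PropositionalEquality
open import Relation.Nullary using (Dec; yes; no; ¬_; contradiction)
open import Relation.Nullary.Decidable using (⌊_⌋; dec⇒maybe; from-yes; T?; _→-dec_)
open import Tactic.RingSolver using (solve-∀)
open import Tactic.RingSolver.Core.AlmostCommutativeRing using (AlmostCommutativeRing; fromCommutativeRing)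

private variable
  A B : Set
  k m m′ n : ℕ

-- Rationals from ℕ and ℤ, and finite sums

ℚ-ring : AlmostCommutativeRing _ _
ℚ-ring = fromCommutativeRing ℚ.+-*-commutativeRing (λ x → dec⇒maybe (0ℚ ℚ.≟ x))

∑ : List A → (A → ℚ) → ℚ
∑ L f = sumℚ (map f L)

syntax ∑ L (λ x → e) = ∑[ x ∈ L ] e

𝟙 : Bool → ℚ
𝟙 true  = 1ℚ
𝟙 false = 0ℚ

ℤ/1-normal : ∀ i → i ℚ./ 1 ≡ ℚ.mkℚ i 0 (Coprimality.sym (1-coprimeTo ℤ.∣ i ∣))
ℤ/1-normal i = ℚ.↥p/↧p≡p _

ℤ/1-+ : ∀ i j → i ℚ./ 1 + j ℚ./ 1 ≡ (i ℤ.+ j) ℚ./ 1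
ℤ/1-+ i j = trans (cong₂ _+_ (ℤ/1-normal i) (ℤ/1-normal j))
  (ℚ./-cong (cong₂ ℤ._+_ (ℤ.*-identityʳ i) (ℤ.*-identityʳ j)) refl)

ℤ/1-* : ∀ i j → (i ℚ./ 1) * (j ℚ./ 1) ≡ (i ℤ.* j) ℚ./ 1
ℤ/1-* i j = cong₂ _*_ (ℤ/1-normal i) (ℤ/1-normal j)

ℤ/1-neg : ∀ i → ℚ.- (i ℚ./ 1) ≡ (ℤ.- i) ℚ./ 1
ℤ/1-neg i = begin
  ℚ.- (i ℚ./ 1)                            ≡⟨ sym (ℚ.+-identityˡ _) ⟩
  0ℚ - i ℚ./ 1                             ≡⟨ cong (_- i ℚ./ 1) (cong (ℚ._/ 1) (sym (ℤ.+-inverseˡ i))) ⟩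
  (ℤ.- i ℤ.+ i) ℚ./ 1 - i ℚ./ 1            ≡⟨ cong (_- i ℚ./ 1) (sym (ℤ/1-+ (ℤ.- i) i)) ⟩
  ((ℤ.- i) ℚ./ 1 + i ℚ./ 1) - i ℚ./ 1      ≡⟨ cancel ((ℤ.- i) ℚ./ 1) (i ℚ./ 1) ⟩
  (ℤ.- i) ℚ./ 1                            ∎
  where
  open ≡-Reasoning
  cancel : ∀ a b → (a + b) - b ≡ a
  cancel = solve-∀ ℚ-ring

ℤ/1-minus : ∀ i j → i ℚ./ 1 - j ℚ./ 1 ≡ (i ℤ.- j) ℚ./ 1
ℤ/1-minus i j = trans (cong (i ℚ./ 1 +_) (ℤ/1-neg j)) (ℤ/1-+ i (ℤ.- j))

ℤ/2≡ℤ/1*½ : ∀ i → i ℚ./ 2 ≡ i ℚ./ 1 * ½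
ℤ/2≡ℤ/1*½ i = sym (trans (cong (_* ½) (ℤ/1-normal i)) (ℚ./-cong (ℤ.*-identityʳ i) refl))

ℕ→ℚ-+ : ∀ a b → ℕ→ℚ (a ℕ.+ b) ≡ ℕ→ℚ a + ℕ→ℚ b
ℕ→ℚ-+ a b = sym (ℤ/1-+ (ℤ.+ a) (ℤ.+ b))

ℕ→ℚ-injective : ∀ {a b} → ℕ→ℚ a ≡ ℕ→ℚ b → a ≡ b
ℕ→ℚ-injective {a} {b} eq = ℤ.+-injective (begin
  ℤ.+ a                   ≡⟨ cong ℚ.↥_ (ℤ/1-normal (ℤ.+ a)) ⟨
  ℚ.↥ ℕ→ℚ a               ≡⟨ cong ℚ.↥_ eq ⟩
  ℚ.↥ ℕ→ℚ b               ≡⟨ cong ℚ.↥_ (ℤ/1-normal (ℤ.+ b)) ⟩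
  ℤ.+ b                   ∎)
  where open ≡-Reasoning

ℕ→ℚ[a+b]-a≡b : ∀ a b → ℕ→ℚ (a ℕ.+ b) - ℕ→ℚ a ≡ ℕ→ℚ b
ℕ→ℚ[a+b]-a≡b a b = trans (cong (_- ℕ→ℚ a) (ℕ→ℚ-+ a b)) (cancel (ℕ→ℚ a) (ℕ→ℚ b))
  where
  cancel : ∀ x y → x + y - x ≡ y
  cancel = solve-∀ ℚ-ring

ℕ→ℚ-invertible : ∀ d → ∃ λ y → y * ℕ→ℚ (suc d) ≡ 1ℚ
ℕ→ℚ-invertible d = ℚ.1/ p , trans (cong (ℚ.1/ p *_) (ℤ/1-normal (ℤ.+ suc d))) (ℚ.*-inverseˡ p)
  where p = ℚ.mkℚ (ℤ.+ suc d) 0 (Coprimality.sym (1-coprimeTo (suc d)))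

∑-cong : (L : List A) {f g : A → ℚ} → (∀ x → f x ≡ g x) → ∑ L f ≡ ∑ L g
∑-cong []      f≗g = refl
∑-cong (x ∷ L) f≗g = cong₂ _+_ (f≗g x) (∑-cong L f≗g)

∑-zero : (L : List A) {f : A → ℚ} → (∀ x → f x ≡ 0ℚ) → ∑ L f ≡ 0ℚ
∑-zero []      f≗0 = refl
∑-zero (x ∷ L) f≗0 = cong₂ _+_ (f≗0 x) (∑-zero L f≗0)

∑-distrib-+ : (L : List A) (f g : A → ℚ) → ∑[ x ∈ L ] (f x + g x) ≡ ∑ L f + ∑ L g
∑-distrib-+ []      f g = refl
∑-distrib-+ (x ∷ L) f g = begin
  (f x + g x) + ∑[ y ∈ L ] (f y + g y) ≡⟨ cong ((f x + g x) +_) (∑-distrib-+ L f g) ⟩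
  (f x + g x) + (∑ L f + ∑ L g)       ≡⟨ interchange (f x) (g x) (∑ L f) (∑ L g) ⟩
  (f x + ∑ L f) + (g x + ∑ L g)       ∎
  where
  open ≡-Reasoning
  interchange : ∀ a b c d → (a + b) + (c + d) ≡ (a + c) + (b + d)
  interchange = solve-∀ ℚ-ring

∑-*ˡ : (L : List A) (c : ℚ) (f : A → ℚ) → ∑[ x ∈ L ] (c * f x) ≡ c * ∑ L f
∑-*ˡ []      c f = sym (ℚ.*-zeroʳ c)
∑-*ˡ (x ∷ L) c f = trans (cong (c * f x +_) (∑-*ˡ L c f)) (sym (ℚ.*-distribˡ-+ c (f x) (∑ L f)))

∑-*ʳ : (L : List A) (c : ℚ) (f : A → ℚ) → ∑[ x ∈ L ] (f x * c) ≡ ∑ L f * c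
∑-*ʳ L c f = trans (∑-cong L (λ x → ℚ.*-comm (f x) c)) (trans (∑-*ˡ L c f) (ℚ.*-comm c (∑ L f)))

∑-neg : (L : List A) (f : A → ℚ) → ∑[ x ∈ L ] (ℚ.- f x) ≡ ℚ.- ∑ L f
∑-neg []      f = refl
∑-neg (x ∷ L) f = trans (cong (ℚ.- f x +_) (∑-neg L f)) (sym (ℚ.neg-distrib-+ (f x) (∑ L f)))

∑-distrib-minus : (L : List A) (f g : A → ℚ) → ∑[ x ∈ L ] (f x - g x) ≡ ∑ L f - ∑ L g
∑-distrib-minus L f g = trans (∑-distrib-+ L f (λ x → ℚ.- g x)) (cong (∑ L f +_) (∑-neg L g))

∑-const : (L : List A) (c : ℚ) → ∑[ _ ∈ L ] c ≡ c * ℕ→ℚ (length L)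
∑-const []      c = sym (ℚ.*-zeroʳ c)
∑-const (x ∷ L) c = begin
  c + ∑[ _ ∈ L ] c                ≡⟨ cong (c +_) (∑-const L c) ⟩
  c + c * ℕ→ℚ (length L)          ≡⟨ shift c (ℕ→ℚ (length L)) ⟩
  c * (1ℚ + ℕ→ℚ (length L))       ≡⟨ cong (c *_) (sym (ℕ→ℚ-+ 1 (length L))) ⟩
  c * ℕ→ℚ (suc (length L))        ∎
  where
  open ≡-Reasoning
  shift : ∀ c m → c + c * m ≡ c * (1ℚ + m)
  shift = solve-∀ ℚ-ring

∑-++ : (L M : List A) (f : A → ℚ) → ∑ (L ++ M) f ≡ ∑ L f + ∑ M f
∑-++ []      M f = sym (ℚ.+-identityˡ _)
∑-++ (x ∷ L) M f = trans (cong (f x +_) (∑-++ L M f)) (sym (ℚ.+-assoc (f x) (∑ L f) (∑ M f)))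

∑-map : (L : List B) (g : B → A) (f : A → ℚ) → ∑ (map g L) f ≡ ∑[ y ∈ L ] f (g y)
∑-map []      g f = refl
∑-map (y ∷ L) g f = cong (f (g y) +_) (∑-map L g f)

∑-concatMap : (L : List B) (g : B → List A) (f : A → ℚ) →
              ∑ (concatMap g L) f ≡ ∑[ y ∈ L ] ∑ (g y) f
∑-concatMap []      g f = refl
∑-concatMap (y ∷ L) g f = trans (∑-++ (g y) (concatMap g L) f) (cong (∑ (g y) f +_) (∑-concatMap L g f))

∑-comm : (L : List A) (M : List B) (f : A → B → ℚ) →
         ∑[ x ∈ L ] ∑[ y ∈ M ] f x y ≡ ∑[ y ∈ M ] ∑[ x ∈ L ] f x y
∑-comm []      M f = sym (∑-zero M (λ _ → refl))
∑-comm (x ∷ L) M f = trans (cong (∑ M (f x) +_) (∑-comm L M f)) (sym (∑-distrib-+ M (f x) (λ y → ∑[ x′ ∈ L ] f x′ y)))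

∑-mul : (L : List A) (M : List B) (f : A → ℚ) (g : B → ℚ) →
        ∑[ x ∈ L ] ∑[ y ∈ M ] (f x * g y) ≡ ∑ L f * ∑ M g
∑-mul L M f g = trans (∑-cong L (λ x → ∑-*ˡ M (f x) g)) (∑-*ʳ L (∑ M g) f)

count≡∑𝟙 : (f : A → Bool) (L : List A) → ℕ→ℚ (count f L) ≡ ∑[ x ∈ L ] 𝟙 (f x)
count≡∑𝟙 f []      = refl
count≡∑𝟙 f (x ∷ L) with f x
... | true  = trans (ℕ→ℚ-+ 1 (count f L)) (cong (1ℚ +_) (count≡∑𝟙 f L))
... | false = trans (sym (ℚ.+-identityˡ _)) (cong (0ℚ +_) (count≡∑𝟙 f L))

foldr+≡∑ : (f : A → ℕ) (L : List A) → ℕ→ℚ (foldr ℕ._+_ 0 (map f L)) ≡ ∑[ x ∈ L ] ℕ→ℚ (f x)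
foldr+≡∑ f []      = refl
foldr+≡∑ f (x ∷ L) = trans (ℕ→ℚ-+ (f x) _) (cong (ℕ→ℚ (f x) +_) (foldr+≡∑ f L))

𝟙-∧ : ∀ a b → 𝟙 (a ∧ b) ≡ 𝟙 a * 𝟙 b
𝟙-∧ true  b = sym (ℚ.*-identityˡ (𝟙 b))
𝟙-∧ false b = sym (ℚ.*-zeroˡ (𝟙 b))

𝟙-∨ : ∀ a b → 𝟙 (a ∨ b) ≡ 𝟙 a + 𝟙 b - 𝟙 a * 𝟙 b
𝟙-∨ true  true  = refl
𝟙-∨ true  false = refl
𝟙-∨ false true  = refl
𝟙-∨ false false = refl

𝟙-not : ∀ a → 𝟙 (not a) ≡ 1ℚ - 𝟙 a
𝟙-not true  = refl
𝟙-not false = refl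

if≡𝟙* : ∀ b (x : ℚ) → (if b then x else 0ℚ) ≡ 𝟙 b * x
if≡𝟙* true  x = sym (ℚ.*-identityˡ x)
if≡𝟙* false x = sym (ℚ.*-zeroˡ x)

∑²-distrib-+ : (L : List A) (M : List B) (f g : A → B → ℚ) →
               ∑[ x ∈ L ] ∑[ y ∈ M ] (f x y + g x y) ≡ ∑[ x ∈ L ] ∑[ y ∈ M ] f x y + ∑[ x ∈ L ] ∑[ y ∈ M ] g x y
∑²-distrib-+ L M f g = trans (∑-cong L (λ x → ∑-distrib-+ M (f x) (g x))) (∑-distrib-+ L _ _)

𝟙-∨-disjoint : ∀ a b → (a ≡ true → b ≡ true → ⊥) → 𝟙 (a ∨ b) ≡ 𝟙 a + 𝟙 b
𝟙-∨-disjoint true  true  a∧b = ⊥-elim (a∧b refl refl)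
𝟙-∨-disjoint true  false _   = refl
𝟙-∨-disjoint false b     _   = sym (ℚ.+-identityˡ (𝟙 b))

∑-distrib-plus-minus : (L : List A) (f g h : A → ℚ) → ∑[ x ∈ L ] (f x + g x - h x) ≡ ∑ L f + ∑ L g - ∑ L h
∑-distrib-plus-minus L f g h = trans (∑-distrib-minus L (λ x → f x + g x) h) (cong (_- ∑ L h) (∑-distrib-+ L f g))

∑-distrib-+₄ : (L : List A) (f₁ f₂ f₃ f₄ : A → ℚ) →
               ∑[ x ∈ L ] (f₁ x + f₂ x + f₃ x + f₄ x) ≡ ∑ L f₁ + ∑ L f₂ + ∑ L f₃ + ∑ L f₄
∑-distrib-+₄ L f₁ f₂ f₃ f₄ = trans (∑-distrib-+ L (λ x → f₁ x + f₂ x + f₃ x) f₄)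
  (cong (_+ ∑ L f₄) (trans (∑-distrib-+ L (λ x → f₁ x + f₂ x) f₃) (cong (_+ ∑ L f₃) (∑-distrib-+ L f₁ f₂))))

∑-comm₂ : {C : Set} (L : List A) (M : List B) (K : List C) (f : A → B → C → ℚ) →
          ∑[ x ∈ L ] ∑[ y ∈ M ] ∑[ z ∈ K ] f x y z ≡ ∑[ y ∈ M ] ∑[ z ∈ K ] ∑[ x ∈ L ] f x y z
∑-comm₂ L M K f = trans (∑-comm L M _) (∑-cong M (λ y → ∑-comm L K (λ x z → f x y z)))

∑²-*ˡ : (L : List A) (M : List B) (c : ℚ) (f : A → B → ℚ) →
        c * ∑[ x ∈ L ] ∑[ y ∈ M ] f x y ≡ ∑[ x ∈ L ] ∑[ y ∈ M ] (c * f x y)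
∑²-*ˡ L M c f = trans (sym (∑-*ˡ L c _)) (∑-cong L (λ x → sym (∑-*ˡ M c (f x))))

∑-cong-All : {P : A → Set} {L : List A} {f g : A → ℚ} → All P L → (∀ {x} → P x → f x ≡ g x) → ∑ L f ≡ ∑ L g
∑-cong-All []         f≗g = refl
∑-cong-All (px ∷ pxs) f≗g = cong₂ _+_ (f≗g px) (∑-cong-All pxs f≗g)

-- Sums over vertices and unordered pairs

_==_ : Fin n → Fin n → Bool
a == b = ⌊ a ≟ b ⌋

==-refl : (a : Fin n) → (a == a) ≡ true
==-refl a with a ≟ a
... | yes _   = refl
... | no a≢a  = ⊥-elim (a≢a refl)

==-sym : (a b : Fin n) → (a == b) ≡ (b == a)
==-sym a b with a ≟ b | b ≟ a
... | yes _   | yes _   = refl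
... | no _    | no _    = refl
... | yes a≡b | no b≢a  = ⊥-elim (b≢a (sym a≡b))
... | no a≢b  | yes b≡a = ⊥-elim (a≢b (sym b≡a))

==-suc : (a b : Fin n) → (suc a == suc b) ≡ (a == b)
==-suc a b with a ≟ b
... | yes _ = refl
... | no _  = refl

≡⇒== : {a b : Fin n} → a ≡ b → (a == b) ≡ true
≡⇒== {a = a} refl = ==-refl a

==⇒≡ : {a b : Fin n} → (a == b) ≡ true → a ≡ b
==⇒≡ {a = a} {b} a==b with a ≟ b
... | yes a≡b = a≡b

≢⇒==-false : {a b : Fin n} → a ≢ b → (a == b) ≡ false
≢⇒==-false {a = a} {b} a≢b with a ≟ b
... | yes a≡b = contradiction a≡b a≢b
... | no _    = refl

lo≢hi : (p : UPair n) → lo p ≢ hi p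
lo≢hi p lo≡hi = Fin.<-irrefl lo≡hi (lt p)

∑-allFin-suc : (f : Fin (suc n) → ℚ) → ∑ (allFin (suc n)) f ≡ f zero + ∑[ i ∈ allFin n ] f (suc i)
∑-allFin-suc {n} f = cong (λ L → f zero + sumℚ L)
  (trans (map-tabulate suc f) (sym (map-tabulate id (λ i → f (suc i)))))

∑-allFin-const : ∀ n (c : ℚ) → ∑[ _ ∈ allFin n ] c ≡ c * ℕ→ℚ n
∑-allFin-const n c = trans (∑-const (allFin n) c) (cong (λ k → c * ℕ→ℚ k) (length-tabulate {n = n} id))

∑-allFin-1 : ∀ n → ∑[ _ ∈ allFin n ] 1ℚ ≡ ℕ→ℚ n
∑-allFin-1 n = trans (∑-allFin-const n 1ℚ) (ℚ.*-identityˡ (ℕ→ℚ n))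

∑-δ : (a : Fin n) (φ : Fin n → ℚ) → ∑[ v ∈ allFin n ] (𝟙 (v == a) * φ v) ≡ φ a
∑-δ {suc n} zero φ = begin
  ∑[ v ∈ allFin (suc n) ] (𝟙 (v == zero) * φ v)     ≡⟨ ∑-allFin-suc (λ v → 𝟙 (v == zero) * φ v) ⟩
  1ℚ * φ zero + ∑[ v ∈ allFin n ] (0ℚ * φ (suc v))
    ≡⟨ cong₂ _+_ (ℚ.*-identityˡ (φ zero)) (∑-zero (allFin n) (λ v → ℚ.*-zeroˡ (φ (suc v)))) ⟩
  φ zero + 0ℚ                                        ≡⟨ ℚ.+-identityʳ _ ⟩
  φ zero                                             ∎
  where open ≡-Reasoning
∑-δ {suc n} (suc a) φ = begin
  ∑[ v ∈ allFin (suc n) ] (𝟙 (v == suc a) * φ v)                ≡⟨ ∑-allFin-suc (λ v → 𝟙 (v == suc a) * φ v) ⟩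
  0ℚ * φ zero + ∑[ v ∈ allFin n ] (𝟙 (suc v == suc a) * φ (suc v))
    ≡⟨ cong₂ _+_ (ℚ.*-zeroˡ (φ zero)) (∑-cong (allFin n) (λ v → cong (λ b → 𝟙 b * φ (suc v)) (==-suc v a))) ⟩
  0ℚ + ∑[ v ∈ allFin n ] (𝟙 (v == a) * φ (suc v))               ≡⟨ ℚ.+-identityˡ _ ⟩
  ∑[ v ∈ allFin n ] (𝟙 (v == a) * φ (suc v))                    ≡⟨ ∑-δ a (λ v → φ (suc v)) ⟩
  φ (suc a)                                                      ∎
  where open ≡-Reasoning

∑-δ′ : (a : Fin n) (φ : Fin n → ℚ) → ∑[ v ∈ allFin n ] (𝟙 (a == v) * φ v) ≡ φ a
∑-δ′ a φ = trans (∑-cong (allFin _) (λ v → cong (λ b → 𝟙 b * φ v) (==-sym a v))) (∑-δ a φ)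

∑-𝟙== : (a : Fin n) → ∑[ v ∈ allFin n ] 𝟙 (v == a) ≡ 1ℚ
∑-𝟙== a = trans (∑-cong (allFin _) (λ v → sym (ℚ.*-identityʳ (𝟙 (v == a))))) (∑-δ a (λ _ → 1ℚ))

∑²-δ : (a b : Fin n) (g : Fin n → Fin n → ℚ) →
       ∑[ i ∈ allFin n ] ∑[ j ∈ allFin n ] (𝟙 (i == a) * (𝟙 (j == b) * g i j)) ≡ g a b
∑²-δ {n} a b g = begin
  ∑[ i ∈ allFin n ] ∑[ j ∈ allFin n ] (𝟙 (i == a) * (𝟙 (j == b) * g i j))
    ≡⟨ ∑-cong (allFin n) (λ i → ∑-*ˡ (allFin n) (𝟙 (i == a)) _) ⟩
  ∑[ i ∈ allFin n ] (𝟙 (i == a) * ∑[ j ∈ allFin n ] (𝟙 (j == b) * g i j))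
    ≡⟨ ∑-δ a _ ⟩
  ∑[ j ∈ allFin n ] (𝟙 (j == b) * g a j)
    ≡⟨ ∑-δ b _ ⟩
  g a b ∎
  where open ≡-Reasoning

∑²-δ′ : (a b : Fin n) (g : Fin n → Fin n → ℚ) →
        ∑[ i ∈ allFin n ] ∑[ j ∈ allFin n ] (𝟙 (a == i) * (𝟙 (b == j) * g i j)) ≡ g a b
∑²-δ′ {n} a b g = trans (∑-cong (allFin n) (λ i → ∑-cong (allFin n) (λ j →
  cong₂ (λ s t → 𝟙 s * (𝟙 t * g i j)) (==-sym a i) (==-sym b j)))) (∑²-δ a b g)

-- Defs builds `allUPairs` from a private helper; unification recovers it.
private
  pairBlocks : ∃ λ (block : ∀ {n} → Fin n → Fin n → List (UPair n)) →
               ∀ n → allUPairs n ≡ concatMap (λ i → concatMap (block i) (allFin n)) (allFin n)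
  pairBlocks = _ , λ n → refl

  block : Fin n → Fin n → List (UPair n)
  block = proj₁ pairBlocks

  ∑-block : (f : Fin n → Fin n → ℚ) (i j : Fin n) →
            ∑[ p ∈ block i j ] f (lo p) (hi p) ≡ 𝟙 ⌊ i <? j ⌋ * f i j
  ∑-block f i j with i <? j
  ... | yes _ = trans (ℚ.+-identityʳ (f i j)) (sym (ℚ.*-identityˡ (f i j)))
  ... | no _  = sym (ℚ.*-zeroˡ (f i j))

∑-upairs : (f : Fin n → Fin n → ℚ) →
           ∑[ p ∈ allUPairs n ] f (lo p) (hi p) ≡ ∑[ i ∈ allFin n ] ∑[ j ∈ allFin n ] (𝟙 ⌊ i <? j ⌋ * f i j)
∑-upairs {n} f = begin
  ∑[ p ∈ allUPairs n ] f (lo p) (hi p)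
    ≡⟨ cong (λ L → ∑[ p ∈ L ] f (lo p) (hi p)) (proj₂ pairBlocks n) ⟩
  ∑[ p ∈ concatMap (λ i → concatMap (block i) (allFin n)) (allFin n) ] f (lo p) (hi p)
    ≡⟨ ∑-concatMap (allFin n) _ _ ⟩
  ∑[ i ∈ allFin n ] ∑[ p ∈ concatMap (block i) (allFin n) ] f (lo p) (hi p)
    ≡⟨ ∑-cong (allFin n) (λ i → trans (∑-concatMap (allFin n) (block i) _) (∑-cong (allFin n) (∑-block f i))) ⟩
  ∑[ i ∈ allFin n ] ∑[ j ∈ allFin n ] (𝟙 ⌊ i <? j ⌋ * f i j) ∎
  where open ≡-Reasoning

private
  ≮∧≯⇒≡ : {a b : Fin n} → ¬ a < b → ¬ b < a → a ≡ b
  ≮∧≯⇒≡ {a = a} {b} a≮b b≮a with Fin.<-cmp a b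
  ... | tri< a<b _ _ = ⊥-elim (a≮b a<b)
  ... | tri≈ _ a≡b _ = a≡b
  ... | tri> _ _ b<a = ⊥-elim (b≮a b<a)

  split-by-order : (f : Fin n → Fin n → ℚ) → (∀ a b → f a b ≡ f b a) → ∀ a b →
                   f a b ≡ 𝟙 ⌊ a <? b ⌋ * f a b + 𝟙 ⌊ b <? a ⌋ * f b a + 𝟙 (a == b) * f a a
  split-by-order f f-sym a b with a <? b | b <? a | a ≟ b
  ... | yes a<b | yes b<a | _        = ⊥-elim (Fin.<-asym a<b b<a)
  ... | yes a<b | no _    | yes refl = ⊥-elim (Fin.<-irrefl refl a<b)
  ... | no _    | yes b<a | yes refl = ⊥-elim (Fin.<-irrefl refl b<a)
  ... | no a≮b  | no b≮a  | no a≢b   = ⊥-elim (a≢b (≮∧≯⇒≡ a≮b b≮a))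
  ... | yes _   | no _    | no _     = first (f a b) (f b a) (f a a)
    where
    first : ∀ x y z → x ≡ 1ℚ * x + 0ℚ * y + 0ℚ * z
    first = solve-∀ ℚ-ring
  ... | no _    | yes _   | no _     = trans (f-sym a b) (second (f a b) (f b a) (f a a))
    where
    second : ∀ x y z → y ≡ 0ℚ * x + 1ℚ * y + 0ℚ * z
    second = solve-∀ ℚ-ring
  ... | no _    | no _    | yes refl = third (f a a)
    where
    third : ∀ x → x ≡ 0ℚ * x + 0ℚ * x + 1ℚ * x
    third = solve-∀ ℚ-ring

∑²-symmetric : (f : Fin n → Fin n → ℚ) → (∀ a b → f a b ≡ f b a) →
               ∑[ a ∈ allFin n ] ∑[ b ∈ allFin n ] f a b ≡
               ∑[ p ∈ allUPairs n ] f (lo p) (hi p) + ∑[ p ∈ allUPairs n ] f (lo p) (hi p) + ∑[ a ∈ allFin n ] f a a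
∑²-symmetric {n} f f-sym = begin
  ∑[ a ∈ V ] ∑[ b ∈ V ] f a b
    ≡⟨ ∑-cong V (λ a → ∑-cong V (split-by-order f f-sym a)) ⟩
  ∑[ a ∈ V ] ∑[ b ∈ V ] (𝟙 ⌊ a <? b ⌋ * f a b + 𝟙 ⌊ b <? a ⌋ * f b a + 𝟙 (a == b) * f a a)
    ≡⟨ trans (∑²-distrib-+ V V _ (λ a b → 𝟙 (a == b) * f a a))
             (cong (_+ ∑[ a ∈ V ] ∑[ b ∈ V ] (𝟙 (a == b) * f a a)) (∑²-distrib-+ V V _ _)) ⟩
  ∑[ a ∈ V ] ∑[ b ∈ V ] (𝟙 ⌊ a <? b ⌋ * f a b) + ∑[ a ∈ V ] ∑[ b ∈ V ] (𝟙 ⌊ b <? a ⌋ * f b a)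
    + ∑[ a ∈ V ] ∑[ b ∈ V ] (𝟙 (a == b) * f a a)
    ≡⟨ cong₂ _+_ (cong₂ _+_ (sym (∑-upairs f)) (∑-comm V V _)) (∑-cong V (λ a → ∑-δ′ a (λ _ → f a a))) ⟩
  S + ∑[ b ∈ V ] ∑[ a ∈ V ] (𝟙 ⌊ b <? a ⌋ * f b a) + ∑[ a ∈ V ] f a a
    ≡⟨ cong (λ x → S + x + ∑[ a ∈ V ] f a a) (sym (∑-upairs f)) ⟩
  S + S + ∑[ a ∈ V ] f a a ∎
  where
  open ≡-Reasoning
  V = allFin n
  S = ∑[ p ∈ allUPairs n ] f (lo p) (hi p)

∑-upairs-half : (f : Fin n → Fin n → ℚ) → (∀ a b → f a b ≡ f b a) →
                ∑[ p ∈ allUPairs n ] f (lo p) (hi p) ≡ (∑[ a ∈ allFin n ] ∑[ b ∈ allFin n ] f a b - ∑[ a ∈ allFin n ] f a a) * ½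
∑-upairs-half {n} f f-sym =
  trans (halve S (∑[ a ∈ allFin n ] f a a)) (cong (λ s → (s - ∑[ a ∈ allFin n ] f a a) * ½) (sym (∑²-symmetric f f-sym)))
  where
  S = ∑[ p ∈ allUPairs n ] f (lo p) (hi p)
  halve : ∀ s d → s ≡ ((s + s + d) - d) * ½
  halve = solve-∀ ℚ-ring

_≐_ : UPair n → UPair n → Bool
p ≐ q = (lo p == lo q) ∧ (hi p == hi q)

≐⇒≡ : {p q : UPair n} → (p ≐ q) ≡ true → p ≡ q
≐⇒≡ {p = upair a b a<b} {upair c d c<d} p≐q with a ≟ c | b ≟ d
≐⇒≡ {p = upair a b a<b} {upair a b c<d} _ | yes refl | yes refl = cong (upair a b) (Fin.<-irrelevant a<b c<d)

≐-refl : (p : UPair n) → (p ≐ p) ≡ true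
≐-refl p rewrite ==-refl (lo p) | ==-refl (hi p) = refl

≐-sym : (p q : UPair n) → (p ≐ q) ≡ (q ≐ p)
≐-sym p q = cong₂ _∧_ (==-sym (lo p) (lo q)) (==-sym (hi p) (hi q))

≢⇒≐-false : {p q : UPair n} → p ≢ q → (p ≐ q) ≡ false
≢⇒≐-false {p = p} {q} p≢q with p ≐ q in p≐q
... | true  = contradiction (≐⇒≡ p≐q) p≢q
... | false = refl

∑-δ-upairs : (q : UPair n) (w : UPair n → ℚ) → ∑[ r ∈ allUPairs n ] (𝟙 (r ≐ q) * w r) ≡ w q
∑-δ-upairs {n} q w = begin
  ∑[ r ∈ allUPairs n ] (𝟙 (r ≐ q) * w r)
    ≡⟨ ∑-cong (allUPairs n) sift ⟩
  ∑[ r ∈ allUPairs n ] (𝟙 (r ≐ q) * w q)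
    ≡⟨ ∑-*ʳ (allUPairs n) (w q) (λ r → 𝟙 (r ≐ q)) ⟩
  ∑[ r ∈ allUPairs n ] 𝟙 ((lo r == lo q) ∧ (hi r == hi q)) * w q
    ≡⟨ cong (_* w q) (∑-cong (allUPairs n) (λ r → 𝟙-∧ (lo r == lo q) (hi r == hi q))) ⟩
  ∑[ r ∈ allUPairs n ] (𝟙 (lo r == lo q) * 𝟙 (hi r == hi q)) * w q
    ≡⟨ cong (_* w q) (∑-upairs (λ a b → 𝟙 (a == lo q) * 𝟙 (b == hi q))) ⟩
  ∑[ i ∈ allFin n ] ∑[ j ∈ allFin n ] (𝟙 ⌊ i <? j ⌋ * (𝟙 (i == lo q) * 𝟙 (j == hi q))) * w q
    ≡⟨ cong (_* w q) (∑-cong (allFin n) (λ i → ∑-cong (allFin n) (λ j → reorder (𝟙 ⌊ i <? j ⌋) (𝟙 (i == lo q)) (𝟙 (j == hi q))))) ⟩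
  ∑[ i ∈ allFin n ] ∑[ j ∈ allFin n ] (𝟙 (i == lo q) * (𝟙 (j == hi q) * 𝟙 ⌊ i <? j ⌋)) * w q
    ≡⟨ cong (_* w q) (∑²-δ (lo q) (hi q) (λ i j → 𝟙 ⌊ i <? j ⌋)) ⟩
  𝟙 ⌊ lo q <? hi q ⌋ * w q
    ≡⟨ cong (_* w q) lo<hi ⟩
  1ℚ * w q
    ≡⟨ ℚ.*-identityˡ (w q) ⟩
  w q ∎
  where
  open ≡-Reasoning
  sift : ∀ r → 𝟙 (r ≐ q) * w r ≡ 𝟙 (r ≐ q) * w q
  sift r with r ≐ q in r≐q
  ... | true  = cong (1ℚ *_) (cong w (≐⇒≡ r≐q))
  ... | false = trans (ℚ.*-zeroˡ (w r)) (sym (ℚ.*-zeroˡ (w q)))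
  reorder : ∀ x y z → x * (y * z) ≡ y * (z * x)
  reorder = solve-∀ ℚ-ring
  lo<hi : 𝟙 ⌊ lo q <? hi q ⌋ ≡ 1ℚ
  lo<hi with lo q <? hi q
  ... | yes _   = refl
  ... | no lo≮hi = ⊥-elim (lo≮hi (lt q))

𝟙-∈ᵖ : (v : Fin n) (p : UPair n) → 𝟙 (v ∈ᵖ p) ≡ 𝟙 (lo p == v) + 𝟙 (hi p == v)
𝟙-∈ᵖ v p = 𝟙-∨-disjoint (lo p == v) (hi p == v) (λ l h → lo≢hi p (trans (==⇒≡ l) (sym (==⇒≡ h))))

∑-∈ᵖ : (p : UPair n) → ∑[ v ∈ allFin n ] 𝟙 (v ∈ᵖ p) ≡ 1ℚ + 1ℚ
∑-∈ᵖ {n} p = begin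
  ∑[ v ∈ allFin n ] 𝟙 (v ∈ᵖ p)                                   ≡⟨ ∑-cong (allFin n) (λ v → 𝟙-∈ᵖ v p) ⟩
  ∑[ v ∈ allFin n ] (𝟙 (lo p == v) + 𝟙 (hi p == v))              ≡⟨ ∑-distrib-+ (allFin n) _ _ ⟩
  ∑[ v ∈ allFin n ] 𝟙 (lo p == v) + ∑[ v ∈ allFin n ] 𝟙 (hi p == v) ≡⟨ cong₂ _+_ (one (lo p)) (one (hi p)) ⟩
  1ℚ + 1ℚ                                                         ∎
  where
  open ≡-Reasoning
  one : ∀ a → ∑[ v ∈ allFin n ] 𝟙 (a == v) ≡ 1ℚ
  one a = trans (∑-cong (allFin n) (λ v → cong 𝟙 (==-sym a v))) (∑-𝟙== a)

∑-pairs-through : (i : Fin n) (ψ : Fin n → Fin n → ℚ) → (∀ a b → ψ a b ≡ ψ b a) →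
                  ∑[ p ∈ allUPairs n ] (𝟙 (i ∈ᵖ p) * ψ (lo p) (hi p)) ≡ ∑[ b ∈ allFin n ] ψ i b - ψ i i
∑-pairs-through {n} i ψ ψ-sym = begin
  ∑[ p ∈ allUPairs n ] g (lo p) (hi p)
    ≡⟨ ∑-upairs-half g g-sym ⟩
  (∑[ a ∈ V ] ∑[ b ∈ V ] g a b - ∑[ a ∈ V ] g a a) * ½
    ≡⟨ cong₂ (λ s d → (s - d) * ½) square diagonal ⟩
  (R + R - ψ i i - ψ i i) * ½
    ≡⟨ halve R (ψ i i) ⟩
  R - ψ i i ∎
  where
  open ≡-Reasoning
  V = allFin n
  R = ∑[ b ∈ V ] ψ i b
  g : Fin n → Fin n → ℚ
  g a b = 𝟙 ((a == i) ∨ (b == i)) * ψ a b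
  g-sym : ∀ a b → g a b ≡ g b a
  g-sym a b = cong₂ _*_ (cong 𝟙 (∨-comm (a == i) (b == i))) (ψ-sym a b)
  halve : ∀ r d → (r + r - d - d) * ½ ≡ r - d
  halve = solve-∀ ℚ-ring
  diagonal : ∑[ a ∈ V ] g a a ≡ ψ i i
  diagonal = trans (∑-cong V (λ a → cong (λ b → 𝟙 b * ψ a a) (∨-idem (a == i)))) (∑-δ i (λ a → ψ a a))
  expand : ∀ a b → g a b ≡ 𝟙 (a == i) * ψ a b + 𝟙 (b == i) * ψ a b - 𝟙 (a == i) * (𝟙 (b == i) * ψ a b)
  expand a b = trans (cong (_* ψ a b) (𝟙-∨ (a == i) (b == i))) (distrib (𝟙 (a == i)) (𝟙 (b == i)) (ψ a b))
    where
    distrib : ∀ x y z → (x + y - x * y) * z ≡ x * z + y * z - x * (y * z)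
    distrib = solve-∀ ℚ-ring
  square : ∑[ a ∈ V ] ∑[ b ∈ V ] g a b ≡ R + R - ψ i i
  square = begin
    ∑[ a ∈ V ] ∑[ b ∈ V ] g a b
      ≡⟨ ∑-cong V (λ a → trans (∑-cong V (expand a)) (∑-distrib-plus-minus V _ _ _)) ⟩
    ∑[ a ∈ V ] (∑[ b ∈ V ] (𝟙 (a == i) * ψ a b) + ∑[ b ∈ V ] (𝟙 (b == i) * ψ a b)
                - ∑[ b ∈ V ] (𝟙 (a == i) * (𝟙 (b == i) * ψ a b)))
      ≡⟨ ∑-distrib-plus-minus V _ _ _ ⟩
    ∑[ a ∈ V ] ∑[ b ∈ V ] (𝟙 (a == i) * ψ a b) + ∑[ a ∈ V ] ∑[ b ∈ V ] (𝟙 (b == i) * ψ a b)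
      - ∑[ a ∈ V ] ∑[ b ∈ V ] (𝟙 (a == i) * (𝟙 (b == i) * ψ a b))
      ≡⟨ cong₂ _-_ (cong₂ _+_ (trans (∑-cong V (λ a → ∑-*ˡ V (𝟙 (a == i)) (ψ a))) (∑-δ i (λ a → ∑[ b ∈ V ] ψ a b)))
                              (∑-cong V (λ a → trans (∑-δ i (ψ a)) (ψ-sym a i))))
                   (∑²-δ i i ψ) ⟩
    R + R - ψ i i ∎

sameEdge : Fin n → Fin n → Fin n → Fin n → Bool
sameEdge a b x y = ((a == x) ∧ (b == y)) ∨ ((a == y) ∧ (b == x))

sameEdge-comm : (a b x y : Fin n) → sameEdge a b x y ≡ sameEdge b a x y
sameEdge-comm a b x y = trans (∨-comm ((a == x) ∧ (b == y)) _) (cong₂ _∨_ (∧-comm (a == y) (b == x)) (∧-comm (a == x) (b == y)))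

incident : Fin n → Fin n → Fin n → Bool
incident a b x = (a == x) ∨ (b == x)

sameEdge≡≐ : (p q : UPair n) → sameEdge (lo p) (hi p) (lo q) (hi q) ≡ (p ≐ q)
sameEdge≡≐ p q = begin
  ((lo p == lo q) ∧ (hi p == hi q)) ∨ ((lo p == hi q) ∧ (hi p == lo q)) ≡⟨ cong (((lo p == lo q) ∧ (hi p == hi q)) ∨_) crossed ⟩
  ((lo p == lo q) ∧ (hi p == hi q)) ∨ false                             ≡⟨ ∨-identityʳ _ ⟩
  p ≐ q                                                                 ∎
  where
  open ≡-Reasoning
  crossed : ((lo p == hi q) ∧ (hi p == lo q)) ≡ false
  crossed with lo p ≟ hi q | hi p ≟ lo q
  ... | yes refl | yes refl = ⊥-elim (Fin.<-asym (lt p) (lt q))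
  ... | yes _    | no _     = refl
  ... | no _     | _        = refl

∑-sameEdge-δ : {x y : Fin n} → x ≢ y → (Ψ : Fin n → Fin n → ℚ) → (∀ a b → Ψ a b ≡ Ψ b a) →
               ∑[ r ∈ allUPairs n ] (𝟙 (sameEdge x y (lo r) (hi r)) * Ψ (lo r) (hi r)) ≡ Ψ x y
∑-sameEdge-δ {n} {x} {y} x≢y Ψ Ψ-sym = begin
  ∑[ r ∈ allUPairs n ] g (lo r) (hi r)                   ≡⟨ ∑-upairs-half g g-sym ⟩
  (∑[ a ∈ V ] ∑[ b ∈ V ] g a b - ∑[ a ∈ V ] g a a) * ½   ≡⟨ cong₂ (λ s d → (s - d) * ½) square diagonal ⟩
  (Ψ x y + Ψ x y - 0ℚ) * ½                               ≡⟨ halve (Ψ x y) ⟩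
  Ψ x y                                                  ∎
  where
  open ≡-Reasoning
  V = allFin n
  g : Fin n → Fin n → ℚ
  g a b = 𝟙 (sameEdge x y a b) * Ψ a b
  g-sym : ∀ a b → g a b ≡ g b a
  g-sym a b = cong₂ _*_ (cong 𝟙 (∨-comm ((x == a) ∧ (y == b)) ((x == b) ∧ (y == a)))) (Ψ-sym a b)
  halve : ∀ s → (s + s - 0ℚ) * ½ ≡ s
  halve = solve-∀ ℚ-ring
  diagonal : ∑[ a ∈ V ] g a a ≡ 0ℚ
  diagonal = ∑-zero V (λ a → trans (cong (λ b → 𝟙 b * Ψ a a) (never a)) (ℚ.*-zeroˡ (Ψ a a)))
    where
    never : ∀ a → sameEdge x y a a ≡ false
    never a with x ≟ a | y ≟ a
    ... | yes refl | yes refl = ⊥-elim (x≢y refl)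
    ... | yes _    | no _     = refl
    ... | no _     | _        = refl
  disjoint : ∀ a b → ((x == a) ∧ (y == b)) ≡ true → ((x == b) ∧ (y == a)) ≡ true → ⊥
  disjoint a b with x ≟ a | y ≟ a
  ... | yes refl | yes refl = λ _ _ → x≢y refl
  ... | yes _    | no _     = λ _ x=b∧false → contradiction (trans (sym x=b∧false) (∧-zeroʳ (x == b))) λ ()
  ... | no _     | _        = λ ()
  split : ∀ a b → g a b ≡ 𝟙 (x == a) * (𝟙 (y == b) * Ψ a b) + 𝟙 (y == a) * (𝟙 (x == b) * Ψ a b)
  split a b = begin
    𝟙 (((x == a) ∧ (y == b)) ∨ ((x == b) ∧ (y == a))) * Ψ a b
      ≡⟨ cong (_* Ψ a b) (𝟙-∨-disjoint ((x == a) ∧ (y == b)) ((x == b) ∧ (y == a)) (disjoint a b)) ⟩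
    (𝟙 ((x == a) ∧ (y == b)) + 𝟙 ((x == b) ∧ (y == a))) * Ψ a b
      ≡⟨ cong₂ (λ s t → (s + t) * Ψ a b) (𝟙-∧ (x == a) (y == b)) (𝟙-∧ (x == b) (y == a)) ⟩
    (𝟙 (x == a) * 𝟙 (y == b) + 𝟙 (x == b) * 𝟙 (y == a)) * Ψ a b
      ≡⟨ distrib (𝟙 (x == a)) (𝟙 (y == b)) (𝟙 (x == b)) (𝟙 (y == a)) (Ψ a b) ⟩
    𝟙 (x == a) * (𝟙 (y == b) * Ψ a b) + 𝟙 (y == a) * (𝟙 (x == b) * Ψ a b) ∎
    where
    distrib : ∀ p q r s t → (p * q + r * s) * t ≡ p * (q * t) + s * (r * t)
    distrib = solve-∀ ℚ-ring
  square : ∑[ a ∈ V ] ∑[ b ∈ V ] g a b ≡ Ψ x y + Ψ x y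
  square = begin
    ∑[ a ∈ V ] ∑[ b ∈ V ] g a b
      ≡⟨ trans (∑-cong V (λ a → ∑-cong V (split a))) (∑²-distrib-+ V V _ _) ⟩
    ∑[ a ∈ V ] ∑[ b ∈ V ] (𝟙 (x == a) * (𝟙 (y == b) * Ψ a b)) + ∑[ a ∈ V ] ∑[ b ∈ V ] (𝟙 (y == a) * (𝟙 (x == b) * Ψ a b))
      ≡⟨ cong₂ _+_ (∑²-δ′ x y Ψ) (trans (∑²-δ′ y x Ψ) (Ψ-sym y x)) ⟩
    Ψ x y + Ψ x y ∎

∑-sameEdge-δʳ : {x y : Fin n} → x ≢ y → (Ψ : Fin n → Fin n → ℚ) → (∀ a b → Ψ a b ≡ Ψ b a) →
                ∑[ t ∈ allUPairs n ] (Ψ (lo t) (hi t) * 𝟙 (sameEdge x y (lo t) (hi t))) ≡ Ψ x y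
∑-sameEdge-δʳ {n} x≢y Ψ Ψ-sym =
  trans (∑-cong (allUPairs n) (λ t → ℚ.*-comm (Ψ (lo t) (hi t)) _)) (∑-sameEdge-δ x≢y Ψ Ψ-sym)

-- The orthogonal projection onto W_n and its trace against a vertex map

InW⇒∑-incident≡0 : {w : Vec n} → InW w → ∀ v → ∑[ q ∈ allUPairs n ] (𝟙 (v ∈ᵖ q) * w q) ≡ 0ℚ
InW⇒∑-incident≡0 {n} {w} w∈W v = trans (∑-cong (allUPairs n) (λ q → sym (if≡𝟙* (v ∈ᵖ q) (w q)))) (w∈W v)

-- Each pair has two endpoints, so twice the total of w is the sum of its n vertex sums.
InW⇒∑≡0 : {w : Vec n} → InW w → ∑ (allUPairs n) w ≡ 0ℚ
InW⇒∑≡0 {n} {w} w∈W = begin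
  ∑ U w                                             ≡⟨ by-ring (∑ U w) ⟩
  ((1ℚ + 1ℚ) * ∑ U w) * ½                           ≡⟨ cong (_* ½) (∑-*ˡ U (1ℚ + 1ℚ) w) ⟨
  ∑[ q ∈ U ] ((1ℚ + 1ℚ) * w q) * ½                  ≡⟨ cong (_* ½) (∑-cong U (λ q → cong (_* w q) (∑-∈ᵖ q))) ⟨
  ∑[ q ∈ U ] (∑[ v ∈ V ] 𝟙 (v ∈ᵖ q) * w q) * ½      ≡⟨ cong (_* ½) (∑-cong U (λ q → ∑-*ʳ V (w q) (λ v → 𝟙 (v ∈ᵖ q)))) ⟨
  ∑[ q ∈ U ] ∑[ v ∈ V ] (𝟙 (v ∈ᵖ q) * w q) * ½      ≡⟨ cong (_* ½) (∑-comm U V (λ q v → 𝟙 (v ∈ᵖ q) * w q)) ⟩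
  ∑[ v ∈ V ] ∑[ q ∈ U ] (𝟙 (v ∈ᵖ q) * w q) * ½      ≡⟨ cong (_* ½) (∑-zero V (InW⇒∑-incident≡0 w∈W)) ⟩
  0ℚ * ½                                            ≡⟨ ℚ.*-zeroˡ ½ ⟩
  0ℚ                                                ∎
  where
  open ≡-Reasoning
  U = allUPairs n
  V = allFin n
  by-ring : ∀ s → s ≡ ((1ℚ + 1ℚ) * s) * ½
  by-ring = solve-∀ ℚ-ring

#fixed : (Fin n → Fin n) → ℚ
#fixed {n} σ = ∑[ v ∈ allFin n ] 𝟙 (v == σ v)

∑²-stablePairs : (σ : Fin n → Fin n) →
  ∑[ a ∈ allFin n ] ∑[ b ∈ allFin n ] 𝟙 (sameEdge a b (σ a) (σ b)) ≡ #fixed σ * #fixed σ + #fixed (λ v → σ (σ v)) - #fixed σ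
∑²-stablePairs {n} σ = begin
  ∑[ a ∈ V ] ∑[ b ∈ V ] 𝟙 (((a == σ a) ∧ (b == σ b)) ∨ ((a == σ b) ∧ (b == σ a)))
    ≡⟨ ∑-cong V (λ a → ∑-cong V (λ b → split a b)) ⟩
  ∑[ a ∈ V ] ∑[ b ∈ V ] (fixed a b + swapped a b - fixed a b * swapped a b)
    ≡⟨ trans (∑-cong V (λ a → ∑-distrib-plus-minus V _ _ _)) (∑-distrib-plus-minus V _ _ _) ⟩
  ∑[ a ∈ V ] ∑[ b ∈ V ] fixed a b + ∑[ a ∈ V ] ∑[ b ∈ V ] swapped a b - ∑[ a ∈ V ] ∑[ b ∈ V ] (fixed a b * swapped a b)
    ≡⟨ cong₂ _-_ (cong₂ _+_ (∑-mul V V (λ a → 𝟙 (a == σ a)) (λ b → 𝟙 (b == σ b))) ∑²-swapped) ∑²-both ⟩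
  #fixed σ * #fixed σ + #fixed (λ v → σ (σ v)) - #fixed σ ∎
  where
  open ≡-Reasoning
  V = allFin n
  fixed swapped : Fin n → Fin n → ℚ
  fixed a b = 𝟙 (a == σ a) * 𝟙 (b == σ b)
  swapped a b = 𝟙 (b == σ a) * 𝟙 (a == σ b)
  split : ∀ a b → 𝟙 (((a == σ a) ∧ (b == σ b)) ∨ ((a == σ b) ∧ (b == σ a))) ≡ fixed a b + swapped a b - fixed a b * swapped a b
  split a b = trans (𝟙-∨ ((a == σ a) ∧ (b == σ b)) ((a == σ b) ∧ (b == σ a)))
    (cong₂ (λ u v → u + v - u * v) (𝟙-∧ (a == σ a) (b == σ b))
           (trans (𝟙-∧ (a == σ b) (b == σ a)) (ℚ.*-comm (𝟙 (a == σ b)) (𝟙 (b == σ a)))))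
  ∑²-swapped : ∑[ a ∈ V ] ∑[ b ∈ V ] swapped a b ≡ #fixed (λ v → σ (σ v))
  ∑²-swapped = ∑-cong V (λ a → ∑-δ (σ a) (λ b → 𝟙 (a == σ b)))
  fixed⇒2-fixed : ∀ a → 𝟙 (a == σ a) * (𝟙 (σ a == σ (σ a)) * 𝟙 (a == σ (σ a))) ≡ 𝟙 (a == σ a)
  fixed⇒2-fixed a with a ≟ σ a
  ... | no _    = ℚ.*-zeroˡ (𝟙 (σ a == σ (σ a)) * 𝟙 (a == σ (σ a)))
  ... | yes a≡σa rewrite ≡⇒== (cong σ a≡σa) | ≡⇒== (trans a≡σa (cong σ a≡σa)) = refl
  reorder : ∀ p q r s → (p * q) * (r * s) ≡ r * (p * (q * s))
  reorder = solve-∀ ℚ-ring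
  ∑²-both : ∑[ a ∈ V ] ∑[ b ∈ V ] (fixed a b * swapped a b) ≡ #fixed σ
  ∑²-both = ∑-cong V (λ a → begin
    ∑[ b ∈ V ] (fixed a b * swapped a b)
      ≡⟨ ∑-cong V (λ b → reorder (𝟙 (a == σ a)) (𝟙 (b == σ b)) (𝟙 (b == σ a)) (𝟙 (a == σ b))) ⟩
    ∑[ b ∈ V ] (𝟙 (b == σ a) * (𝟙 (a == σ a) * (𝟙 (b == σ b) * 𝟙 (a == σ b))))
      ≡⟨ ∑-δ (σ a) (λ b → 𝟙 (a == σ a) * (𝟙 (b == σ b) * 𝟙 (a == σ b))) ⟩
    𝟙 (a == σ a) * (𝟙 (σ a == σ (σ a)) * 𝟙 (a == σ (σ a)))
      ≡⟨ fixed⇒2-fixed a ⟩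
    𝟙 (a == σ a) ∎)

∑-𝟙-incident : ∀ i x → ∑[ b ∈ allFin n ] 𝟙 (incident i b x) ≡ 𝟙 (i == x) * (ℕ→ℚ n - 1ℚ) + 1ℚ
∑-𝟙-incident {n} i x with i ≟ x
... | yes _ = trans (∑-allFin-1 n) (everything (ℕ→ℚ n))
  where
  everything : ∀ m → m ≡ 1ℚ * (m - 1ℚ) + 1ℚ
  everything = solve-∀ ℚ-ring
... | no _  = trans (∑-𝟙== x) (only-x (ℕ→ℚ n))
  where
  only-x : ∀ m → 1ℚ ≡ 0ℚ * (m - 1ℚ) + 1ℚ
  only-x = solve-∀ ℚ-ring

∑-sameEdge : ∀ i {x y} → x ≢ y → ∑[ b ∈ allFin n ] 𝟙 (sameEdge i b x y) ≡ 𝟙 (i == x) + 𝟙 (i == y)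
∑-sameEdge {n} i {x} {y} x≢y with i ≟ x | i ≟ y
... | yes refl | yes refl = ⊥-elim (x≢y refl)
... | yes refl | no _     = trans (∑-cong (allFin n) (λ b → cong 𝟙 (∨-identityʳ (b == y))))
                                  (trans (∑-𝟙== y) (sym (ℚ.+-identityʳ 1ℚ)))
... | no _     | yes refl = trans (∑-𝟙== x) (sym (ℚ.+-identityˡ 1ℚ))
... | no _     | no _     = ∑-zero (allFin n) (λ _ → refl)

∑²-incident∘σ : (σ : Fin n → Fin n) →
                ∑[ a ∈ allFin n ] ∑[ b ∈ allFin n ] 𝟙 (incident a b (σ a)) ≡ #fixed σ * (ℕ→ℚ n - 1ℚ) + ℕ→ℚ n
∑²-incident∘σ {n} σ = begin
  ∑[ a ∈ V ] ∑[ b ∈ V ] 𝟙 (incident a b (σ a))             ≡⟨ ∑-cong V (λ a → ∑-𝟙-incident a (σ a)) ⟩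
  ∑[ a ∈ V ] (𝟙 (a == σ a) * (ℕ→ℚ n - 1ℚ) + 1ℚ)            ≡⟨ ∑-distrib-+ V _ _ ⟩
  ∑[ a ∈ V ] (𝟙 (a == σ a) * (ℕ→ℚ n - 1ℚ)) + ∑[ _ ∈ V ] 1ℚ
    ≡⟨ cong₂ _+_ (∑-*ʳ V (ℕ→ℚ n - 1ℚ) (λ a → 𝟙 (a == σ a))) (∑-allFin-1 n) ⟩
  #fixed σ * (ℕ→ℚ n - 1ℚ) + ℕ→ℚ n                          ∎
  where
  open ≡-Reasoning
  V = allFin n

∑²-incident∘σ′ : (σ : Fin n → Fin n) →
                 ∑[ a ∈ allFin n ] ∑[ b ∈ allFin n ] 𝟙 (incident a b (σ b)) ≡ #fixed σ * (ℕ→ℚ n - 1ℚ) + ℕ→ℚ n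
∑²-incident∘σ′ {n} σ = trans (∑-comm (allFin n) (allFin n) (λ a b → 𝟙 (incident a b (σ b))))
  (trans (∑-cong (allFin n) (λ b → ∑-cong (allFin n) (λ a → cong 𝟙 (∨-comm (a == σ b) (b == σ b))))) (∑²-incident∘σ σ))

module Projection {n : ℕ} (α γ : ℚ) where

  -- P₀ = I − ∂ᵀ(∂∂ᵀ)⁻¹∂ for the incidence map ∂ : V_n → ℚⁿ, whose kernel is W_n: as ∂∂ᵀ = (n−2)I + J,
  -- (∂∂ᵀ)⁻¹ = α(I − γJ/2) once α(n−2) = γ(n−1) = 1, and (∂ᵀ∂)_pq = |p ∩ q|.
  π : Fin n → Fin n → Fin n → Fin n → ℚ
  π a b x y = 𝟙 (sameEdge a b x y) - α * (𝟙 (incident a b x) + 𝟙 (incident a b y) - (γ + γ))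

  P₀ : Mat n
  P₀ p q = π (lo p) (hi p) (lo q) (hi q)

  π-comm : ∀ a b x y → π a b x y ≡ π b a x y
  π-comm a b x y = cong₂ (λ s t → 𝟙 s - α * t) (sameEdge-comm a b x y)
    (cong₂ (λ u v → 𝟙 u + 𝟙 v - (γ + γ)) (∨-comm (a == x) (b == x)) (∨-comm (a == y) (b == y)))

  π-comm′ : ∀ a b x y → π a b x y ≡ π a b y x
  π-comm′ a b x y = cong₂ (λ s t → 𝟙 s - α * (t - (γ + γ)))
    (∨-comm ((a == x) ∧ (b == y)) _) (ℚ.+-comm (𝟙 (incident a b x)) (𝟙 (incident a b y)))

  overlap-comm : (p q : UPair n) → 𝟙 (lo q ∈ᵖ p) + 𝟙 (hi q ∈ᵖ p) ≡ 𝟙 (lo p ∈ᵖ q) + 𝟙 (hi p ∈ᵖ q)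
  overlap-comm p q = begin
    𝟙 (lo q ∈ᵖ p) + 𝟙 (hi q ∈ᵖ p)
      ≡⟨ cong₂ _+_ (𝟙-∈ᵖ (lo q) p) (𝟙-∈ᵖ (hi q) p) ⟩
    (𝟙 (lo p == lo q) + 𝟙 (hi p == lo q)) + (𝟙 (lo p == hi q) + 𝟙 (hi p == hi q))
      ≡⟨ cong₂ _+_ (cong₂ _+_ (δ-sym (lo p) (lo q)) (δ-sym (hi p) (lo q))) (cong₂ _+_ (δ-sym (lo p) (hi q)) (δ-sym (hi p) (hi q))) ⟩
    (𝟙 (lo q == lo p) + 𝟙 (lo q == hi p)) + (𝟙 (hi q == lo p) + 𝟙 (hi q == hi p))
      ≡⟨ interchange (𝟙 (lo q == lo p)) (𝟙 (lo q == hi p)) (𝟙 (hi q == lo p)) (𝟙 (hi q == hi p)) ⟩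
    (𝟙 (lo q == lo p) + 𝟙 (hi q == lo p)) + (𝟙 (lo q == hi p) + 𝟙 (hi q == hi p))
      ≡⟨ cong₂ _+_ (𝟙-∈ᵖ (lo p) q) (𝟙-∈ᵖ (hi p) q) ⟨
    𝟙 (lo p ∈ᵖ q) + 𝟙 (hi p ∈ᵖ q) ∎
    where
    open ≡-Reasoning
    δ-sym : ∀ a b → 𝟙 (a == b) ≡ 𝟙 (b == a)
    δ-sym a b = cong 𝟙 (==-sym a b)
    interchange : ∀ a b c d → (a + b) + (c + d) ≡ (a + c) + (b + d)
    interchange = solve-∀ ℚ-ring

  P₀-symmetric : (p q : UPair n) → P₀ p q ≡ P₀ q p
  P₀-symmetric p q = cong₂ (λ s t → 𝟙 s - α * (t - (γ + γ)))
    (trans (sameEdge≡≐ p q) (trans (≐-sym p q) (sym (sameEdge≡≐ q p)))) (overlap-comm p q)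

  P₀-fixes-W : (w : Vec n) → InW w → ∀ p → apply P₀ w p ≡ w p
  P₀-fixes-W w w∈W p = begin
    ∑[ q ∈ U ] (P₀ p q * w q)
      ≡⟨ ∑-cong U (λ q → trans (cong (_* w q) (P₀-symmetric p q)) (expand q)) ⟩
    ∑[ q ∈ U ] (𝟙 (q ≐ p) * w q - α * (𝟙 (lo p ∈ᵖ q) * w q + 𝟙 (hi p ∈ᵖ q) * w q - (γ + γ) * w q))
      ≡⟨ ∑-distrib-minus U _ _ ⟩
    ∑[ q ∈ U ] (𝟙 (q ≐ p) * w q) - ∑[ q ∈ U ] (α * (𝟙 (lo p ∈ᵖ q) * w q + 𝟙 (hi p ∈ᵖ q) * w q - (γ + γ) * w q))
      ≡⟨ cong₂ _-_ (∑-δ-upairs p w) (trans (∑-*ˡ U α _) (cong (α *_) (∑-distrib-plus-minus U _ _ _))) ⟩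
    w p - α * (∑[ q ∈ U ] (𝟙 (lo p ∈ᵖ q) * w q) + ∑[ q ∈ U ] (𝟙 (hi p ∈ᵖ q) * w q) - ∑[ q ∈ U ] ((γ + γ) * w q))
      ≡⟨ cong (λ t → w p - α * t) (cong₂ _-_ (cong₂ _+_ (InW⇒∑-incident≡0 w∈W (lo p)) (InW⇒∑-incident≡0 w∈W (hi p)))
                                              (trans (∑-*ˡ U (γ + γ) w) (cong ((γ + γ) *_) (InW⇒∑≡0 w∈W)))) ⟩
    w p - α * (0ℚ + 0ℚ - (γ + γ) * 0ℚ)
      ≡⟨ vanish (w p) α γ ⟩
    w p ∎
    where
    open ≡-Reasoning
    U = allUPairs n
    distrib : ∀ e a b c g x → (e - a * (b + c - g)) * x ≡ e * x - a * (b * x + c * x - g * x)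
    distrib = solve-∀ ℚ-ring
    expand : ∀ q → P₀ q p * w q ≡ 𝟙 (q ≐ p) * w q - α * (𝟙 (lo p ∈ᵖ q) * w q + 𝟙 (hi p ∈ᵖ q) * w q - (γ + γ) * w q)
    expand q = trans (cong (λ s → (𝟙 s - α * (𝟙 (lo p ∈ᵖ q) + 𝟙 (hi p ∈ᵖ q) - (γ + γ))) * w q) (sameEdge≡≐ q p))
                     (distrib (𝟙 (q ≐ p)) α (𝟙 (lo p ∈ᵖ q)) (𝟙 (hi p ∈ᵖ q)) (γ + γ) (w q))
    vanish : ∀ x a g → x - a * (0ℚ + 0ℚ - (g + g) * 0ℚ) ≡ x
    vanish = solve-∀ ℚ-ring

  π-diagonal : ∀ i {x y} → x ≢ y → π i i x y ≡ 0ℚ - α * (𝟙 (i == x) + 𝟙 (i == y) - (γ + γ))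
  π-diagonal i {x} {y} x≢y = cong₂ (λ s t → 𝟙 s - α * t) never
    (cong₂ (λ u v → 𝟙 u + 𝟙 v - (γ + γ)) (∨-idem (i == x)) (∨-idem (i == y)))
    where
    never : sameEdge i i x y ≡ false
    never with i ≟ x | i ≟ y
    ... | yes refl | yes refl = ⊥-elim (x≢y refl)
    ... | yes refl | no _     = refl
    ... | no _     | yes refl = refl
    ... | no _     | no _     = refl

  ∑-π : ∀ i {x y} → x ≢ y → ∑[ b ∈ allFin n ] π i b x y ≡
        𝟙 (i == x) + 𝟙 (i == y)
        - α * ((𝟙 (i == x) * (ℕ→ℚ n - 1ℚ) + 1ℚ) + (𝟙 (i == y) * (ℕ→ℚ n - 1ℚ) + 1ℚ) - (γ + γ) * ℕ→ℚ n)
  ∑-π i {x} {y} x≢y = begin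
    ∑[ b ∈ V ] π i b x y
      ≡⟨ ∑-distrib-minus V _ _ ⟩
    ∑[ b ∈ V ] 𝟙 (sameEdge i b x y) - ∑[ b ∈ V ] (α * (𝟙 (incident i b x) + 𝟙 (incident i b y) - (γ + γ)))
      ≡⟨ cong₂ _-_ (∑-sameEdge i x≢y) (trans (∑-*ˡ V α _) (cong (α *_) (∑-distrib-plus-minus V _ _ _))) ⟩
    𝟙 (i == x) + 𝟙 (i == y)
      - α * (∑[ b ∈ V ] 𝟙 (incident i b x) + ∑[ b ∈ V ] 𝟙 (incident i b y) - ∑[ _ ∈ V ] (γ + γ))
      ≡⟨ cong (λ t → 𝟙 (i == x) + 𝟙 (i == y) - α * t)
              (cong₂ _-_ (cong₂ _+_ (∑-𝟙-incident i x) (∑-𝟙-incident i y)) (∑-allFin-const n (γ + γ))) ⟩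
    𝟙 (i == x) + 𝟙 (i == y)
      - α * ((𝟙 (i == x) * (ℕ→ℚ n - 1ℚ) + 1ℚ) + (𝟙 (i == y) * (ℕ→ℚ n - 1ℚ) + 1ℚ) - (γ + γ) * ℕ→ℚ n) ∎
    where
    open ≡-Reasoning
    V = allFin n

  χ : (Fin n → Fin n) → ℚ
  χ σ = ∑[ p ∈ allUPairs n ] π (lo p) (hi p) (σ (lo p)) (σ (hi p))

  ∑²-π∘σ : (σ : Fin n → Fin n) → let F = #fixed σ; F₂ = #fixed (λ v → σ (σ v)); N = ℕ→ℚ n in
           ∑[ a ∈ allFin n ] ∑[ b ∈ allFin n ] π a b (σ a) (σ b) ≡
           (F * F + F₂ - F) - α * ((F * (N - 1ℚ) + N) + (F * (N - 1ℚ) + N) - (γ + γ) * N * N)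
  ∑²-π∘σ σ = begin
    ∑[ a ∈ V ] ∑[ b ∈ V ] π a b (σ a) (σ b)
      ≡⟨ trans (∑-cong V (λ a → ∑-distrib-minus V _ _)) (∑-distrib-minus V _ _) ⟩
    stable - ∑[ a ∈ V ] ∑[ b ∈ V ] (α * (𝟙 (incident a b (σ a)) + 𝟙 (incident a b (σ b)) - (γ + γ)))
      ≡⟨ cong (stable -_) (trans (∑-cong V (λ a → ∑-*ˡ V α _)) (∑-*ˡ V α _)) ⟩
    stable - α * ∑[ a ∈ V ] ∑[ b ∈ V ] (𝟙 (incident a b (σ a)) + 𝟙 (incident a b (σ b)) - (γ + γ))
      ≡⟨ cong (λ t → stable - α * t) (trans (∑-cong V (λ a → ∑-distrib-plus-minus V _ _ _)) (∑-distrib-plus-minus V _ _ _)) ⟩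
    stable - α * (∑[ a ∈ V ] ∑[ b ∈ V ] 𝟙 (incident a b (σ a)) + ∑[ a ∈ V ] ∑[ b ∈ V ] 𝟙 (incident a b (σ b))
                  - ∑[ a ∈ V ] ∑[ b ∈ V ] (γ + γ))
      ≡⟨ cong₂ (λ s t → s - α * t) (∑²-stablePairs σ)
               (cong₂ _-_ (cong₂ _+_ (∑²-incident∘σ σ) (∑²-incident∘σ′ σ)) constant) ⟩
    (F * F + F₂ - F) - α * ((F * (N - 1ℚ) + N) + (F * (N - 1ℚ) + N) - (γ + γ) * N * N) ∎
    where
    open ≡-Reasoning
    V = allFin n
    F = #fixed σ
    F₂ = #fixed (λ v → σ (σ v))
    N = ℕ→ℚ n
    stable = ∑[ a ∈ V ] ∑[ b ∈ V ] 𝟙 (sameEdge a b (σ a) (σ b))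
    constant : ∑[ a ∈ V ] ∑[ b ∈ V ] (γ + γ) ≡ (γ + γ) * N * N
    constant = trans (∑-cong V (λ _ → ∑-allFin-const n (γ + γ))) (∑-allFin-const n ((γ + γ) * N))

  ∑-π∘σ-diagonal : (σ : Fin n → Fin n) →
                   ∑[ a ∈ allFin n ] π a a (σ a) (σ a) ≡ #fixed σ - α * (#fixed σ + #fixed σ - (γ + γ) * ℕ→ℚ n)
  ∑-π∘σ-diagonal σ = begin
    ∑[ a ∈ V ] π a a (σ a) (σ a)
      ≡⟨ ∑-cong V (λ a → cong₂ (λ s t → 𝟙 s - α * (𝟙 t + 𝟙 t - (γ + γ))) (same a) (∨-idem (a == σ a))) ⟩
    ∑[ a ∈ V ] (𝟙 (a == σ a) - α * (𝟙 (a == σ a) + 𝟙 (a == σ a) - (γ + γ)))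
      ≡⟨ ∑-distrib-minus V _ _ ⟩
    F - ∑[ a ∈ V ] (α * (𝟙 (a == σ a) + 𝟙 (a == σ a) - (γ + γ)))
      ≡⟨ cong (F -_) (trans (∑-*ˡ V α _) (cong (α *_) (trans (∑-distrib-plus-minus V _ _ _) (cong (F + F -_) (∑-allFin-const n (γ + γ)))))) ⟩
    F - α * (F + F - (γ + γ) * ℕ→ℚ n) ∎
    where
    open ≡-Reasoning
    V = allFin n
    F = #fixed σ
    same : ∀ a → sameEdge a a (σ a) (σ a) ≡ (a == σ a)
    same a = trans (∨-idem ((a == σ a) ∧ (a == σ a))) (∧-idem (a == σ a))

  module _ (α-inv : α * (ℕ→ℚ n - ℕ→ℚ 2) ≡ 1ℚ) (γ-inv : γ * (ℕ→ℚ n - 1ℚ) ≡ 1ℚ) where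

    P₀-column-∈W : ∀ q → InW (λ p → P₀ p q)
    P₀-column-∈W q i = begin
      ∑[ p ∈ allUPairs n ] (if i ∈ᵖ p then P₀ p q else 0ℚ)
        ≡⟨ ∑-cong (allUPairs n) (λ p → if≡𝟙* (i ∈ᵖ p) (P₀ p q)) ⟩
      ∑[ p ∈ allUPairs n ] (𝟙 (i ∈ᵖ p) * π (lo p) (hi p) x y)
        ≡⟨ ∑-pairs-through i (λ a b → π a b x y) (λ a b → π-comm a b x y) ⟩
      ∑[ b ∈ allFin n ] π i b x y - π i i x y
        ≡⟨ cong₂ _-_ (∑-π i x≢y) (π-diagonal i x≢y) ⟩
      cx + cy - α * ((cx * (N - 1ℚ) + 1ℚ) + (cy * (N - 1ℚ) + 1ℚ) - (γ + γ) * N) - (0ℚ - α * (cx + cy - (γ + γ)))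
        ≡⟨ regroup cx cy α γ N ⟩
      (cx + cy) * (1ℚ - α * (N - ℕ→ℚ 2)) - (α + α) * (1ℚ - γ * (N - 1ℚ))
        ≡⟨ cong₂ (λ s t → (cx + cy) * (1ℚ - s) - (α + α) * (1ℚ - t)) α-inv γ-inv ⟩
      (cx + cy) * (1ℚ - 1ℚ) - (α + α) * (1ℚ - 1ℚ)
        ≡⟨ vanish (cx + cy) (α + α) ⟩
      0ℚ ∎
      where
      open ≡-Reasoning
      x = lo q
      y = hi q
      x≢y = lo≢hi q
      cx = 𝟙 (i == x)
      cy = 𝟙 (i == y)
      N = ℕ→ℚ n
      regroup : ∀ cx cy a g N →
        cx + cy - a * ((cx * (N - 1ℚ) + 1ℚ) + (cy * (N - 1ℚ) + 1ℚ) - (g + g) * N) - (0ℚ - a * (cx + cy - (g + g)))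
        ≡ (cx + cy) * (1ℚ - a * (N - ℕ→ℚ 2)) - (a + a) * (1ℚ - g * (N - 1ℚ))
      regroup = solve-∀ ℚ-ring
      vanish : ∀ s t → s * (1ℚ - 1ℚ) - t * (1ℚ - 1ℚ) ≡ 0ℚ
      vanish = solve-∀ ℚ-ring

    -- P = P₀P = (PP₀)ᵀ = P₀ᵀ = P₀, as both are symmetric, map into W and fix it.
    orthProjW≡P₀ : (P : Mat n) → IsOrthProjW P → ∀ p q → P p q ≡ P₀ p q
    orthProjW≡P₀ P (P-into-W , P-fixes-W , P-symmetric) p q = begin
      P p q                             ≡⟨ P₀-fixes-W (λ r → P r q) (column-∈W q) p ⟨
      ∑[ r ∈ U ] (P₀ p r * P r q)       ≡⟨ ∑-cong U (λ r → trans (cong₂ _*_ (P₀-symmetric p r) (P-symmetric r q))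
                                                                  (ℚ.*-comm (P₀ r p) (P q r))) ⟩
      ∑[ r ∈ U ] (P q r * P₀ r p)       ≡⟨ P-fixes-W (λ r → P₀ r p) (P₀-column-∈W p) q ⟩
      P₀ q p                            ≡⟨ P₀-symmetric q p ⟩
      P₀ p q                            ∎
      where
      open ≡-Reasoning
      U = allUPairs n
      column-∈W : ∀ q → InW (λ r → P r q)
      column-∈W q i = trans (∑-cong U (λ r → cong (if i ∈ᵖ r then_else 0ℚ) (sym (P-column r))))
                            (P-into-W (λ s → 𝟙 (s ≐ q)) i)
        where
        P-column : ∀ r → apply P (λ s → 𝟙 (s ≐ q)) r ≡ P r q
        P-column r = trans (∑-cong U (λ s → ℚ.*-comm (P r s) (𝟙 (s ≐ q)))) (∑-δ-upairs q (P r))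

    χ-fixedPoints : (σ : Fin n → Fin n) →
                    χ σ ≡ (#fixed σ * #fixed σ + #fixed (λ v → σ (σ v)) - ℕ→ℚ 4 * #fixed σ) * ½
    χ-fixedPoints σ = begin
      χ σ
        ≡⟨ ∑-upairs-half (λ a b → π a b (σ a) (σ b)) (λ a b → trans (π-comm a b (σ a) (σ b)) (π-comm′ b a (σ a) (σ b))) ⟩
      (∑[ a ∈ allFin n ] ∑[ b ∈ allFin n ] π a b (σ a) (σ b) - ∑[ a ∈ allFin n ] π a a (σ a) (σ a)) * ½
        ≡⟨ cong₂ (λ s d → (s - d) * ½) (∑²-π∘σ σ) (∑-π∘σ-diagonal σ) ⟩
      ((F * F + F₂ - F) - α * ((F * (N - 1ℚ) + N) + (F * (N - 1ℚ) + N) - (γ + γ) * N * N) - (F - α * (F + F - (γ + γ) * N))) * ½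
        ≡⟨ regroup F F₂ α γ N ⟩
      (F * F + F₂ - ℕ→ℚ 4 * F - (1ℚ + 1ℚ) * F * (α * (N - ℕ→ℚ 2) - 1ℚ) - (1ℚ + 1ℚ) * α * N * (1ℚ - γ * (N - 1ℚ))) * ½
        ≡⟨ cong₂ (λ s t → (F * F + F₂ - ℕ→ℚ 4 * F - (1ℚ + 1ℚ) * F * (s - 1ℚ) - (1ℚ + 1ℚ) * α * N * (1ℚ - t)) * ½)
                 α-inv γ-inv ⟩
      (F * F + F₂ - ℕ→ℚ 4 * F - (1ℚ + 1ℚ) * F * (1ℚ - 1ℚ) - (1ℚ + 1ℚ) * α * N * (1ℚ - 1ℚ)) * ½
        ≡⟨ simplify (F * F + F₂ - ℕ→ℚ 4 * F) F α N ⟩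
      (F * F + F₂ - ℕ→ℚ 4 * F) * ½ ∎
      where
      open ≡-Reasoning
      F = #fixed σ
      F₂ = #fixed (λ v → σ (σ v))
      N = ℕ→ℚ n
      regroup : ∀ F F₂ a g N →
        ((F * F + F₂ - F) - a * ((F * (N - 1ℚ) + N) + (F * (N - 1ℚ) + N) - (g + g) * N * N) - (F - a * (F + F - (g + g) * N))) * ½
        ≡ (F * F + F₂ - ℕ→ℚ 4 * F - (1ℚ + 1ℚ) * F * (a * (N - ℕ→ℚ 2) - 1ℚ) - (1ℚ + 1ℚ) * a * N * (1ℚ - g * (N - 1ℚ))) * ½
      regroup = solve-∀ ℚ-ring
      simplify : ∀ x F a N → (x - (1ℚ + 1ℚ) * F * (1ℚ - 1ℚ) - (1ℚ + 1ℚ) * a * N * (1ℚ - 1ℚ)) * ½ ≡ x * ½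
      simplify = solve-∀ ℚ-ring

-- The trace of P₀ X_G³ as a sum over ordered triples of edges

swap-fixes : {a b x : Fin n} → x ≢ a → x ≢ b → swap a b x ≡ x
swap-fixes x≢a x≢b rewrite ≢⇒==-false x≢a | ≢⇒==-false x≢b = refl

swap-first : (a b : Fin n) → swap a b a ≡ b
swap-first a b rewrite ==-refl a = refl

swap-second : (a b : Fin n) → swap a b b ≡ a
swap-second a b with b ≟ a
... | yes refl = refl
... | no _ rewrite ==-refl b = refl

swap-involutive : (a b x : Fin n) → swap a b (swap a b x) ≡ x
swap-involutive a b x = by-cases (x ≟ a) (x ≟ b)
  where
  twice = λ y → swap a b (swap a b y)
  by-cases : Dec (x ≡ a) → Dec (x ≡ b) → twice x ≡ x
  by-cases (yes x≡a) _ = trans (cong twice x≡a) (trans (cong (swap a b) (swap-first a b)) (trans (swap-second a b) (sym x≡a)))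
  by-cases (no _) (yes x≡b) = trans (cong twice x≡b) (trans (cong (swap a b) (swap-second a b)) (trans (swap-first a b) (sym x≡b)))
  by-cases (no x≢a) (no x≢b) = trans (cong (swap a b) (swap-fixes x≢a x≢b)) (swap-fixes x≢a x≢b)

τ : UPair n → Fin n → Fin n
τ e = swap (lo e) (hi e)

τ-≢ : (e : UPair n) {x y : Fin n} → x ≢ y → τ e x ≢ τ e y
τ-≢ e x≢y τx≡τy = x≢y (trans (sym (swap-involutive (lo e) (hi e) _)) (trans (cong (τ e) τx≡τy) (swap-involutive (lo e) (hi e) _)))

τ³ : UPair n → UPair n → UPair n → Fin n → Fin n
τ³ e₁ e₂ e₃ v = τ e₁ (τ e₂ (τ e₃ v))

module _ (G : Graph n) where

  private
    U = allUPairs n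
    E = edges G
    X = XG G

  X-entry : ∀ r s → X r s ≡ ∑[ e ∈ E ] 𝟙 (sameEdge (τ e (lo s)) (τ e (hi s)) (lo r) (hi r))
  X-entry r s = count≡∑𝟙 (λ e → sends (τ e) s r) E

  X-collapse : ∀ r {x y} → x ≢ y →
               ∑[ t ∈ U ] (X r t * 𝟙 (sameEdge x y (lo t) (hi t))) ≡ ∑[ e ∈ E ] 𝟙 (sameEdge (τ e x) (τ e y) (lo r) (hi r))
  X-collapse r x≢y = trans (∑-cong U (λ t → cong (_* _) (X-entry r t)))
    (∑-sameEdge-δʳ x≢y (λ a b → ∑[ e ∈ E ] 𝟙 (sameEdge (τ e a) (τ e b) (lo r) (hi r)))
                       (λ a b → ∑-cong E (λ e → cong 𝟙 (sameEdge-comm (τ e a) (τ e b) (lo r) (hi r)))))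

  X²-entry : ∀ s p → (X · X) s p ≡
             ∑[ e₃ ∈ E ] ∑[ e₂ ∈ E ] 𝟙 (sameEdge (τ e₂ (τ e₃ (lo p))) (τ e₂ (τ e₃ (hi p))) (lo s) (hi s))
  X²-entry s p = begin
    ∑[ t ∈ U ] (X s t * X t p)
      ≡⟨ ∑-cong U (λ t → trans (cong (X s t *_) (X-entry t p)) (sym (∑-*ˡ E (X s t) _))) ⟩
    ∑[ t ∈ U ] ∑[ e₃ ∈ E ] (X s t * 𝟙 (sameEdge (τ e₃ (lo p)) (τ e₃ (hi p)) (lo t) (hi t)))
      ≡⟨ ∑-comm U E _ ⟩
    ∑[ e₃ ∈ E ] ∑[ t ∈ U ] (X s t * 𝟙 (sameEdge (τ e₃ (lo p)) (τ e₃ (hi p)) (lo t) (hi t)))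
      ≡⟨ ∑-cong E (λ e₃ → X-collapse s (τ-≢ e₃ (lo≢hi p))) ⟩
    ∑[ e₃ ∈ E ] ∑[ e₂ ∈ E ] 𝟙 (sameEdge (τ e₂ (τ e₃ (lo p))) (τ e₂ (τ e₃ (hi p))) (lo s) (hi s)) ∎
    where open ≡-Reasoning

  X³-entry : ∀ r p → (X · (X · X)) r p ≡
             ∑[ e₃ ∈ E ] ∑[ e₂ ∈ E ] ∑[ e₁ ∈ E ] 𝟙 (sameEdge (τ³ e₁ e₂ e₃ (lo p)) (τ³ e₁ e₂ e₃ (hi p)) (lo r) (hi r))
  X³-entry r p = begin
    ∑[ s ∈ U ] (X r s * (X · X) s p)
      ≡⟨ ∑-cong U (λ s → trans (cong (X r s *_) (X²-entry s p)) (∑²-*ˡ E E (X r s) _)) ⟩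
    ∑[ s ∈ U ] ∑[ e₃ ∈ E ] ∑[ e₂ ∈ E ] (X r s * 𝟙 (sameEdge (τ e₂ (τ e₃ (lo p))) (τ e₂ (τ e₃ (hi p))) (lo s) (hi s)))
      ≡⟨ ∑-comm₂ U E E _ ⟩
    ∑[ e₃ ∈ E ] ∑[ e₂ ∈ E ] ∑[ s ∈ U ] (X r s * 𝟙 (sameEdge (τ e₂ (τ e₃ (lo p))) (τ e₂ (τ e₃ (hi p))) (lo s) (hi s)))
      ≡⟨ ∑-cong E (λ e₃ → ∑-cong E (λ e₂ → X-collapse r (τ-≢ e₂ (τ-≢ e₃ (lo≢hi p))))) ⟩
    ∑[ e₃ ∈ E ] ∑[ e₂ ∈ E ] ∑[ e₁ ∈ E ] 𝟙 (sameEdge (τ³ e₁ e₂ e₃ (lo p)) (τ³ e₁ e₂ e₃ (hi p)) (lo r) (hi r)) ∎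
    where open ≡-Reasoning

  module _ (α γ : ℚ) where
    open Projection {n} α γ

    trace-P₀X³ : trace (P₀ · (X · (X · X))) ≡ ∑[ e₃ ∈ E ] ∑[ e₂ ∈ E ] ∑[ e₁ ∈ E ] χ (τ³ e₁ e₂ e₃)
    trace-P₀X³ = begin
      ∑[ p ∈ U ] ∑[ r ∈ U ] (P₀ p r * (X · (X · X)) r p)
        ≡⟨ ∑-cong U (λ p → ∑-cong U (λ r → distribute p r)) ⟩
      ∑[ p ∈ U ] ∑[ r ∈ U ] ∑[ e₃ ∈ E ] ∑[ e₂ ∈ E ] ∑[ e₁ ∈ E ] (P₀ p r * hit e₁ e₂ e₃ p r)
        ≡⟨ ∑-cong U (λ p → trans (∑-comm₂ U E E (λ r e₃ e₂ → ∑[ e₁ ∈ E ] (P₀ p r * hit e₁ e₂ e₃ p r)))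
                                 (∑-cong E (λ e₃ → ∑-cong E (λ e₂ → ∑-comm U E (λ r e₁ → P₀ p r * hit e₁ e₂ e₃ p r))))) ⟩
      ∑[ p ∈ U ] ∑[ e₃ ∈ E ] ∑[ e₂ ∈ E ] ∑[ e₁ ∈ E ] ∑[ r ∈ U ] (P₀ p r * hit e₁ e₂ e₃ p r)
        ≡⟨ ∑-cong U (λ p → ∑-cong E (λ e₃ → ∑-cong E (λ e₂ → ∑-cong E (λ e₁ →
             ∑-sameEdge-δʳ {x = τ³ e₁ e₂ e₃ (lo p)} {τ³ e₁ e₂ e₃ (hi p)} (τ-≢ e₁ (τ-≢ e₂ (τ-≢ e₃ (lo≢hi p))))
                           (π (lo p) (hi p)) (π-comm′ (lo p) (hi p)))))) ⟩
      ∑[ p ∈ U ] ∑[ e₃ ∈ E ] ∑[ e₂ ∈ E ] ∑[ e₁ ∈ E ] π (lo p) (hi p) (τ³ e₁ e₂ e₃ (lo p)) (τ³ e₁ e₂ e₃ (hi p))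
        ≡⟨ trans (∑-comm₂ U E E (λ p e₃ e₂ → ∑[ e₁ ∈ E ] χ-term e₁ e₂ e₃ p))
                 (∑-cong E (λ e₃ → ∑-cong E (λ e₂ → ∑-comm U E (λ p e₁ → χ-term e₁ e₂ e₃ p)))) ⟩
      ∑[ e₃ ∈ E ] ∑[ e₂ ∈ E ] ∑[ e₁ ∈ E ] χ (τ³ e₁ e₂ e₃) ∎
      where
      open ≡-Reasoning
      χ-term : UPair n → UPair n → UPair n → UPair n → ℚ
      χ-term e₁ e₂ e₃ p = π (lo p) (hi p) (τ³ e₁ e₂ e₃ (lo p)) (τ³ e₁ e₂ e₃ (hi p))
      hit : UPair n → UPair n → UPair n → UPair n → UPair n → ℚ
      hit e₁ e₂ e₃ p r = 𝟙 (sameEdge (τ³ e₁ e₂ e₃ (lo p)) (τ³ e₁ e₂ e₃ (hi p)) (lo r) (hi r))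
      distribute : ∀ p r → P₀ p r * (X · (X · X)) r p ≡ ∑[ e₃ ∈ E ] ∑[ e₂ ∈ E ] ∑[ e₁ ∈ E ] (P₀ p r * hit e₁ e₂ e₃ p r)
      distribute p r = begin
        P₀ p r * (X · (X · X)) r p
          ≡⟨ cong (P₀ p r *_) (X³-entry r p) ⟩
        P₀ p r * ∑[ e₃ ∈ E ] ∑[ e₂ ∈ E ] ∑[ e₁ ∈ E ] hit e₁ e₂ e₃ p r
          ≡⟨ ∑²-*ˡ E E (P₀ p r) (λ e₃ e₂ → ∑[ e₁ ∈ E ] hit e₁ e₂ e₃ p r) ⟩
        ∑[ e₃ ∈ E ] ∑[ e₂ ∈ E ] (P₀ p r * ∑[ e₁ ∈ E ] hit e₁ e₂ e₃ p r)
          ≡⟨ ∑-cong E (λ e₃ → ∑-cong E (λ e₂ → sym (∑-*ˡ E (P₀ p r) (λ e₁ → hit e₁ e₂ e₃ p r)))) ⟩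
        ∑[ e₃ ∈ E ] ∑[ e₂ ∈ E ] ∑[ e₁ ∈ E ] (P₀ p r * hit e₁ e₂ e₃ p r) ∎

-- Coincidence patterns of the six endpoints of three edges

firstTrue : (Fin k → Bool) → Maybe (Fin k)
firstTrue {zero}  p = nothing
firstTrue {suc k} p = if p zero then just zero else Maybe.map suc (firstTrue (λ i → p (suc i)))

data FirstTrue (p : Fin k → Bool) : Maybe (Fin k) → Set where
  found : ∀ i → p i ≡ true → (∀ j → p j ≡ true → i Fin.≤ j) → FirstTrue p (just i)
  none  : (∀ j → p j ≡ false) → FirstTrue p nothing

firstTrue-spec : (p : Fin k → Bool) → FirstTrue p (firstTrue p)
firstTrue-spec {zero}  p = none (λ ())
firstTrue-spec {suc k} p with p zero in p0
... | true  = found zero p0 (λ _ _ → z≤n)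
... | false with firstTrue (λ i → p (suc i)) | firstTrue-spec (λ i → p (suc i))
...   | just i  | found .i pi least = found (suc i) pi λ where
          zero    p0′ → contradiction (trans (sym p0) p0′) λ ()
          (suc j) pj  → s≤s (least j pj)
...   | nothing | none never = none λ where
          zero    → p0
          (suc j) → never j

firstTrue-cong : {p q : Fin k → Bool} → (∀ i → p i ≡ q i) → firstTrue p ≡ firstTrue q
firstTrue-cong {zero}  p≗q = refl
firstTrue-cong {suc k} p≗q = cong₂ (λ b r → if b then just zero else Maybe.map suc r) (p≗q zero) (firstTrue-cong (λ i → p≗q (suc i)))

module _ (pt : Fin k → Fin m) where

  rep : Fin k → Fin k
  rep s = fromMaybe s (firstTrue (λ t → pt t == pt s))

  rep≤ : ∀ s → rep s Fin.≤ s
  rep≤ s with firstTrue (λ t → pt t == pt s) | firstTrue-spec (λ t → pt t == pt s)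
  ... | just c  | found .c _ least = least s (==-refl (pt s))
  ... | nothing | none never       = contradiction (trans (sym (==-refl (pt s))) (never s)) λ ()

  rep-sound : ∀ s → pt (rep s) ≡ pt s
  rep-sound s with firstTrue (λ t → pt t == pt s) | firstTrue-spec (λ t → pt t == pt s)
  ... | just c  | found .c pc _ = ==⇒≡ pc
  ... | nothing | none _        = refl

  rep-cong : ∀ {i j} → pt i ≡ pt j → rep i ≡ rep j
  rep-cong {i} {j} pti≡ptj rewrite pti≡ptj
    with firstTrue (λ t → pt t == pt j) | firstTrue-spec (λ t → pt t == pt j)
  ... | just c  | _          = refl
  ... | nothing | none never = contradiction (trans (sym (==-refl (pt j))) (never j)) λ ()

  rep-pattern : ∀ i j → (rep i == rep j) ≡ (pt i == pt j)
  rep-pattern i j with pt i ≟ pt j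
  ... | yes pti≡ptj = ≡⇒== (rep-cong pti≡ptj)
  ... | no pti≢ptj with rep i ≟ rep j
  ...   | yes repi≡repj = contradiction (trans (sym (rep-sound i)) (trans (cong pt repi≡repj) (rep-sound j))) pti≢ptj
  ...   | no _ = refl

  ∑-over-points : (φ : Fin m → ℚ) → (∀ v → (∀ s → pt s ≢ v) → φ v ≡ 0ℚ) →
                  ∑[ v ∈ allFin m ] φ v ≡ ∑[ s ∈ allFin k ] (𝟙 (rep s == s) * φ (pt s))
  ∑-over-points φ φ-off = sym (begin
    ∑[ s ∈ S ] (𝟙 (rep s == s) * φ (pt s))
      ≡⟨ ∑-cong S (λ s → cong (𝟙 (rep s == s) *_) (sym (∑-δ′ (pt s) φ))) ⟩
    ∑[ s ∈ S ] (𝟙 (rep s == s) * ∑[ v ∈ V ] (𝟙 (pt s == v) * φ v))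
      ≡⟨ ∑-cong S (λ s → sym (∑-*ˡ V (𝟙 (rep s == s)) _)) ⟩
    ∑[ s ∈ S ] ∑[ v ∈ V ] (𝟙 (rep s == s) * (𝟙 (pt s == v) * φ v))
      ≡⟨ ∑-comm S V _ ⟩
    ∑[ v ∈ V ] ∑[ s ∈ S ] (𝟙 (rep s == s) * (𝟙 (pt s == v) * φ v))
      ≡⟨ ∑-cong V hits ⟩
    ∑[ v ∈ V ] φ v ∎)
    where
    open ≡-Reasoning
    S = allFin k
    V = allFin m
    hits : ∀ v → ∑[ s ∈ S ] (𝟙 (rep s == s) * (𝟙 (pt s == v) * φ v)) ≡ φ v
    hits v with firstTrue (λ t → pt t == v) in first | firstTrue-spec (λ t → pt t == v)
    ... | nothing | none never = trans
      (∑-zero S (λ s → trans (cong (λ b → 𝟙 (rep s == s) * (𝟙 b * φ v)) (never s))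
                             (trans (cong (𝟙 (rep s == s) *_) (ℚ.*-zeroˡ (φ v))) (ℚ.*-zeroʳ (𝟙 (rep s == s))))))
      (sym (φ-off v (λ s pts≡v → contradiction (trans (sym (≡⇒== pts≡v)) (never s)) λ ())))
    ... | just c  | found .c pc _ = begin
      ∑[ s ∈ S ] (𝟙 (rep s == s) * (𝟙 (pt s == v) * φ v))
        ≡⟨ ∑-cong S (λ s → trans (sym (ℚ.*-assoc (𝟙 (rep s == s)) (𝟙 (pt s == v)) (φ v))) (cong (_* φ v) (only-c s))) ⟩
      ∑[ s ∈ S ] (𝟙 (s == c) * φ v)                          ≡⟨ ∑-*ʳ S (φ v) (λ s → 𝟙 (s == c)) ⟩
      ∑[ s ∈ S ] 𝟙 (s == c) * φ v                            ≡⟨ cong (_* φ v) (∑-𝟙== c) ⟩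
      1ℚ * φ v                                               ≡⟨ ℚ.*-identityˡ (φ v) ⟩
      φ v                                                    ∎
      where
      only-c : ∀ s → 𝟙 (rep s == s) * 𝟙 (pt s == v) ≡ 𝟙 (s == c)
      only-c s with pt s ≟ v
      ... | yes refl = trans (ℚ.*-identityʳ (𝟙 (rep s == s))) (cong 𝟙 (trans (cong (λ r → fromMaybe s r == s) first) (==-sym c s)))
      ... | no pts≢v with s ≟ c
      ...   | yes refl = contradiction (==⇒≡ pc) pts≢v
      ...   | no _     = ℚ.*-zeroʳ (𝟙 (rep s == s))

SamePattern : {m′ : ℕ} → (Fin k → Fin m) → (Fin k → Fin m′) → Set
SamePattern pt pt′ = ∀ i j → (pt i == pt j) ≡ (pt′ i == pt′ j)

module _ {m′ : ℕ} {pt : Fin k → Fin m} {pt′ : Fin k → Fin m′} (same : SamePattern pt pt′) where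

  rep-invariant : ∀ s → rep pt s ≡ rep pt′ s
  rep-invariant s = cong (fromMaybe s) (firstTrue-cong (λ t → same t s))

  count-invariant : (Q : Fin m → Bool) (Q′ : Fin m′ → Bool) →
                    (∀ v → (∀ s → pt s ≢ v) → Q v ≡ false) → (∀ v → (∀ s → pt′ s ≢ v) → Q′ v ≡ false) →
                    (∀ s → Q (pt s) ≡ Q′ (pt′ s)) → count Q (allFin m) ≡ count Q′ (allFin m′)
  count-invariant Q Q′ Q-off Q′-off Q≡Q′ = ℕ→ℚ-injective (begin
    ℕ→ℚ (count Q (allFin m))
      ≡⟨ count≡∑𝟙 Q (allFin m) ⟩
    ∑[ v ∈ allFin m ] 𝟙 (Q v)
      ≡⟨ ∑-over-points pt (λ v → 𝟙 (Q v)) (λ v off → cong 𝟙 (Q-off v off)) ⟩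
    ∑[ s ∈ allFin k ] (𝟙 (rep pt s == s) * 𝟙 (Q (pt s)))
      ≡⟨ ∑-cong (allFin k) (λ s → cong₂ (λ r q → 𝟙 (r == s) * 𝟙 q) (rep-invariant s) (Q≡Q′ s)) ⟩
    ∑[ s ∈ allFin k ] (𝟙 (rep pt′ s == s) * 𝟙 (Q′ (pt′ s)))
      ≡⟨ ∑-over-points pt′ (λ v → 𝟙 (Q′ v)) (λ v off → cong 𝟙 (Q′-off v off)) ⟨
    ∑[ v ∈ allFin m′ ] 𝟙 (Q′ v)
      ≡⟨ count≡∑𝟙 Q′ (allFin m′) ⟨
    ℕ→ℚ (count Q′ (allFin m′)) ∎)
    where open ≡-Reasoning

-- Three edges given by their endpoints pt 0, pt 1 | pt 2, pt 3 | pt 4, pt 5, and σ = τ₁ τ₂ τ₃.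
module ThreeSwaps {m : ℕ} (pt : Fin 6 → Fin m) where

  -- Opaque because the normal forms of nested swaps grow exponentially; σ-unfold and swapᵢ-unfold expose them.
  opaque
    σ : Fin m → Fin m
    σ v = swap (pt (# 0)) (pt (# 1)) (swap (pt (# 2)) (pt (# 3)) (swap (pt (# 4)) (pt (# 5)) v))

  covered common : Fin m → Bool
  covered v = incident (pt (# 0)) (pt (# 1)) v ∨ incident (pt (# 2)) (pt (# 3)) v ∨ incident (pt (# 4)) (pt (# 5)) v
  common  v = incident (pt (# 0)) (pt (# 1)) v ∧ incident (pt (# 2)) (pt (# 3)) v ∧ incident (pt (# 4)) (pt (# 5)) v

  repeated : Bool
  repeated = sameEdge (pt (# 0)) (pt (# 1)) (pt (# 2)) (pt (# 3)) ∨ sameEdge (pt (# 2)) (pt (# 3)) (pt (# 4)) (pt (# 5))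
             ∨ sameEdge (pt (# 0)) (pt (# 1)) (pt (# 4)) (pt (# 5))

  proper : Bool
  proper = not (pt (# 0) == pt (# 1)) ∧ not (pt (# 2) == pt (# 3)) ∧ not (pt (# 4) == pt (# 5))

  #covered #moved #moved² #common : ℕ
  #covered = count covered (allFin m)
  #moved   = count (λ v → not (σ v == v)) (allFin m)
  #moved²  = count (λ v → not (σ (σ v) == v)) (allFin m)
  #common  = count common (allFin m)

  opaque
    swapᵢ : Fin 6 → Fin 6 → Fin 6 → Fin 6
    swapᵢ i j s = if pt s == pt i then j else if pt s == pt j then i else s

  opaque
    unfolding swapᵢ

    swapᵢ-unfold : ∀ i j s → swapᵢ i j s ≡ (if pt s == pt i then j else if pt s == pt j then i else s)
    swapᵢ-unfold i j s = refl

  σᵢ : Fin 6 → Fin 6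
  σᵢ s = swapᵢ (# 0) (# 1) (swapᵢ (# 2) (# 3) (swapᵢ (# 4) (# 5) s))

  swap-at : ∀ i j s → swap (pt i) (pt j) (pt s) ≡ pt (swapᵢ i j s)
  swap-at i j s = sym $ trans (cong pt (swapᵢ-unfold i j s)) $
    trans (if-float pt (pt s == pt i)) (cong (if pt s == pt i then pt j else_) (if-float pt (pt s == pt j)))

  opaque
    unfolding σ

    σ-unfold : ∀ v → σ v ≡ swap (pt (# 0)) (pt (# 1)) (swap (pt (# 2)) (pt (# 3)) (swap (pt (# 4)) (pt (# 5)) v))
    σ-unfold v = refl

  σ-at : ∀ s → σ (pt s) ≡ pt (σᵢ s)
  σ-at s = trans (σ-unfold (pt s)) $ trans (cong (λ v → swap (pt (# 0)) (pt (# 1)) (swap (pt (# 2)) (pt (# 3)) v)) (swap-at (# 4) (# 5) s))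
          (trans (cong (swap (pt (# 0)) (pt (# 1))) (swap-at (# 2) (# 3) (swapᵢ (# 4) (# 5) s))) (swap-at (# 0) (# 1) (swapᵢ (# 2) (# 3) (swapᵢ (# 4) (# 5) s))))

  σ²-at : ∀ s → σ (σ (pt s)) ≡ pt (σᵢ (σᵢ s))
  σ²-at s = trans (cong σ (σ-at s)) (σ-at (σᵢ s))

  module _ (v : Fin m) (off : ∀ s → pt s ≢ v) where

    private
      miss : ∀ s → (pt s == v) ≡ false
      miss s = ≢⇒==-false (off s)

      off′ : ∀ s → v ≢ pt s
      off′ s v≡pts = off s (sym v≡pts)

    σ-off : σ v ≡ v
    σ-off rewrite σ-unfold v | swap-fixes (off′ (# 4)) (off′ (# 5)) | swap-fixes (off′ (# 2)) (off′ (# 3))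
                | swap-fixes (off′ (# 0)) (off′ (# 1)) = refl

    covered-off : covered v ≡ false
    covered-off rewrite miss (# 0) | miss (# 1) | miss (# 2) | miss (# 3) | miss (# 4) | miss (# 5) = refl

    common-off : common v ≡ false
    common-off rewrite miss (# 0) | miss (# 1) = refl

    moved-off : not (σ v == v) ≡ false
    moved-off rewrite σ-off = cong not (==-refl v)

    moved²-off : not (σ (σ v) == v) ≡ false
    moved²-off rewrite σ-off | σ-off = cong not (==-refl v)

module _ {pt : Fin 6 → Fin m} {pt′ : Fin 6 → Fin m′} (same : SamePattern pt pt′) where
  private
    module A = ThreeSwaps pt
    module B = ThreeSwaps pt′

    incident-at : ∀ i j s → incident (pt i) (pt j) (pt s) ≡ incident (pt′ i) (pt′ j) (pt′ s)
    incident-at i j s = cong₂ _∨_ (same i s) (same j s)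

    sameEdge-at : ∀ a b c d → sameEdge (pt a) (pt b) (pt c) (pt d) ≡ sameEdge (pt′ a) (pt′ b) (pt′ c) (pt′ d)
    sameEdge-at a b c d = cong₂ _∨_ (cong₂ _∧_ (same a c) (same b d)) (cong₂ _∧_ (same a d) (same b c))

    σᵢ-invariant : ∀ s → A.σᵢ s ≡ B.σᵢ s
    σᵢ-invariant s = trans (cong (A.swapᵢ (# 0) (# 1)) (trans (cong (A.swapᵢ (# 2) (# 3)) (swapᵢ-invariant (# 4) (# 5) s))
                                                        (swapᵢ-invariant (# 2) (# 3) _)))
                           (swapᵢ-invariant (# 0) (# 1) _)
      where
      swapᵢ-invariant : ∀ i j s → A.swapᵢ i j s ≡ B.swapᵢ i j s
      swapᵢ-invariant i j s = trans (A.swapᵢ-unfold i j s)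
        (trans (cong₂ (λ b c → if b then j else if c then i else s) (same s i) (same s j)) (sym (B.swapᵢ-unfold i j s)))

    moved-at : ∀ s → not (A.σ (pt s) == pt s) ≡ not (B.σ (pt′ s) == pt′ s)
    moved-at s = cong not (begin
      A.σ (pt s) == pt s       ≡⟨ cong (_== pt s) (A.σ-at s) ⟩
      pt (A.σᵢ s) == pt s      ≡⟨ same (A.σᵢ s) s ⟩
      pt′ (A.σᵢ s) == pt′ s    ≡⟨ cong (λ t → pt′ t == pt′ s) (σᵢ-invariant s) ⟩
      pt′ (B.σᵢ s) == pt′ s    ≡⟨ cong (_== pt′ s) (B.σ-at s) ⟨
      B.σ (pt′ s) == pt′ s     ∎)
      where open ≡-Reasoning

    moved²-at : ∀ s → not (A.σ (A.σ (pt s)) == pt s) ≡ not (B.σ (B.σ (pt′ s)) == pt′ s)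
    moved²-at s rewrite A.σ²-at s | B.σ²-at s | σᵢ-invariant (A.σᵢ s) | σᵢ-invariant s = cong not (same (B.σᵢ (B.σᵢ s)) s)

  #covered-invariant : A.#covered ≡ B.#covered
  #covered-invariant = count-invariant same A.covered B.covered A.covered-off B.covered-off λ s →
    cong₂ _∨_ (incident-at (# 0) (# 1) s) (cong₂ _∨_ (incident-at (# 2) (# 3) s) (incident-at (# 4) (# 5) s))

  #common-invariant : A.#common ≡ B.#common
  #common-invariant = count-invariant same A.common B.common A.common-off B.common-off λ s →
    cong₂ _∧_ (incident-at (# 0) (# 1) s) (cong₂ _∧_ (incident-at (# 2) (# 3) s) (incident-at (# 4) (# 5) s))

  #moved-invariant : A.#moved ≡ B.#moved
  #moved-invariant = count-invariant same (λ v → not (A.σ v == v)) (λ v → not (B.σ v == v)) A.moved-off B.moved-off moved-at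

  #moved²-invariant : A.#moved² ≡ B.#moved²
  #moved²-invariant = count-invariant same (λ v → not (A.σ (A.σ v) == v)) (λ v → not (B.σ (B.σ v) == v)) A.moved²-off B.moved²-off moved²-at

  proper-invariant : A.proper ≡ B.proper
  proper-invariant = cong₂ _∧_ (cong not (same (# 0) (# 1))) (cong₂ _∧_ (cong not (same (# 2) (# 3))) (cong not (same (# 4) (# 5))))

  repeated-invariant : A.repeated ≡ B.repeated
  repeated-invariant = cong₂ _∨_ (sameEdge-at (# 0) (# 1) (# 2) (# 3))
    (cong₂ _∨_ (sameEdge-at (# 2) (# 3) (# 4) (# 5)) (sameEdge-at (# 0) (# 1) (# 4) (# 5)))

-- Profile r k m₁ m₂ c: whether an edge repeats, k covered vertices, m₁ and m₂ points moved by σ and σ²,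
-- and c vertices lying on all three edges.
data Profile : Bool → ℕ → ℕ → ℕ → ℕ → Set where
  repeatedEdge : ∀ {k c} → Profile true k 2 0 c
  triangle     : Profile false 3 2 0 0
  starOrPath   : ∀ {c} → c ℕ.≤ 1 → Profile false 4 4 4 c
  pathAndEdge  : Profile false 5 5 3 0
  matching     : Profile false 6 6 0 0

Profile-cong : ∀ {r r′ k k′ m₁ m₁′ m₂ m₂′ c c′} → r ≡ r′ → k ≡ k′ → m₁ ≡ m₁′ → m₂ ≡ m₂′ → c ≡ c′ →
               Profile r k m₁ m₂ c → Profile r′ k′ m₁′ m₂′ c′
Profile-cong refl refl refl refl refl p = p

profile? : ∀ r k m₁ m₂ c → Maybe (Profile r k m₁ m₂ c)
profile? true k m₁ m₂ c with m₁ ℕ.≟ 2 | m₂ ℕ.≟ 0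
... | yes refl | yes refl = just repeatedEdge
... | _        | _        = nothing
profile? false 3 m₁ m₂ c with m₁ ℕ.≟ 2 | m₂ ℕ.≟ 0 | c ℕ.≟ 0
... | yes refl | yes refl | yes refl = just triangle
... | _        | _        | _        = nothing
profile? false 4 m₁ m₂ c with m₁ ℕ.≟ 4 | m₂ ℕ.≟ 4 | c ℕ.≤? 1
... | yes refl | yes refl | yes c≤1 = just (starOrPath c≤1)
... | _        | _        | _       = nothing
profile? false 5 m₁ m₂ c with m₁ ℕ.≟ 5 | m₂ ℕ.≟ 3 | c ℕ.≟ 0
... | yes refl | yes refl | yes refl = just pathAndEdge
... | _        | _        | _        = nothing
profile? false 6 m₁ m₂ c with m₁ ℕ.≟ 6 | m₂ ℕ.≟ 0 | c ℕ.≟ 0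
... | yes refl | yes refl | yes refl = just matching
... | _        | _        | _        = nothing
profile? false _ _ _ _ = nothing

profileOf : (pt : Fin 6 → Fin m) → let open ThreeSwaps pt in Maybe (Profile repeated #covered #moved #moved² #common)
profileOf pt = profile? _ _ _ _ _
  where open ThreeSwaps pt

pattern6 : Fin 6 → Fin 6 → Fin 6 → Fin 6 → Fin 6 → Fin 6 → Fin 6 → Fin 6
pattern6 a b c d e f = lookup (a ∷ b ∷ c ∷ d ∷ e ∷ f ∷ [])

-- A coincidence pattern of six endpoints is the kernel of the map sending each position to the first
-- position carrying the same point; such maps c satisfy c k ≤ k, so these 720 cases cover every triple.
AllPatterns : Set
AllPatterns = ∀ a → toℕ a ℕ.≤ 0 → ∀ b → toℕ b ℕ.≤ 1 → ∀ c → toℕ c ℕ.≤ 2 →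
              ∀ d → toℕ d ℕ.≤ 3 → ∀ e → toℕ e ℕ.≤ 4 → ∀ f → toℕ f ℕ.≤ 5 →
  T (ThreeSwaps.proper (pattern6 a b c d e f)) → T (is-just (profileOf (pattern6 a b c d e f)))

opaque
  unfolding ThreeSwaps.σ

  all-patterns : AllPatterns
  all-patterns = from-yes (
    all? λ a → toℕ a ℕ.≤? 0 →-dec all? λ b → toℕ b ℕ.≤? 1 →-dec all? λ c → toℕ c ℕ.≤? 2 →-dec
    all? λ d → toℕ d ℕ.≤? 3 →-dec all? λ e → toℕ e ℕ.≤? 4 →-dec all? λ f → toℕ f ℕ.≤? 5 →-dec
    T? (ThreeSwaps.proper (pattern6 a b c d e f)) →-dec T? (is-just (profileOf (pattern6 a b c d e f))))

endpoints : UPair m → UPair m → UPair m → Fin 6 → Fin m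
endpoints e₁ e₂ e₃ = lookup (lo e₁ ∷ hi e₁ ∷ lo e₂ ∷ hi e₂ ∷ lo e₃ ∷ hi e₃ ∷ [])

triple-profile : (e₁ e₂ e₃ : UPair m) →
                 let open ThreeSwaps (endpoints e₁ e₂ e₃) in Profile repeated #covered #moved #moved² #common
triple-profile e₁ e₂ e₃ = transport (to-witness-T (profileOf model)
  (all-patterns _ (rep≤ pt (# 0)) _ (rep≤ pt (# 1)) _ (rep≤ pt (# 2)) _ (rep≤ pt (# 3)) _ (rep≤ pt (# 4)) _ (rep≤ pt (# 5))
                model-proper))
  where
  pt = endpoints e₁ e₂ e₃
  c = rep pt
  model = pattern6 (c (# 0)) (c (# 1)) (c (# 2)) (c (# 3)) (c (# 4)) (c (# 5))
  module A = ThreeSwaps pt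
  module B = ThreeSwaps model
  model-at : ∀ i → model i ≡ c i
  model-at zero = refl
  model-at (suc zero) = refl
  model-at (suc (suc zero)) = refl
  model-at (suc (suc (suc zero))) = refl
  model-at (suc (suc (suc (suc zero)))) = refl
  model-at (suc (suc (suc (suc (suc zero))))) = refl
  same : SamePattern pt model
  same i j = trans (sym (rep-pattern pt i j)) (cong₂ _==_ (sym (model-at i)) (sym (model-at j)))
  distinct : (e : UPair m) → (lo e == hi e) ≡ false
  distinct e = ≢⇒==-false (lo≢hi e)
  real-proper : T A.proper
  real-proper rewrite distinct e₁ | distinct e₂ | distinct e₃ = _
  model-proper : T B.proper
  model-proper = subst T (proper-invariant same) real-proper
  transport : Profile B.repeated B.#covered B.#moved B.#moved² B.#common →
              Profile A.repeated A.#covered A.#moved A.#moved² A.#common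
  transport = Profile-cong (sym (repeated-invariant same)) (sym (#covered-invariant same)) (sym (#moved-invariant same))
                           (sym (#moved²-invariant same)) (sym (#common-invariant same))

uncurry₃ : (A → A → A → ℚ) → A × A × A → ℚ
uncurry₃ K t = K (proj₁ t) (proj₁ (proj₂ t)) (proj₂ (proj₂ t))

∑-pairsL-∷ : (a : A) (L : List A) (J : A → A → ℚ) →
             ∑ (pairsL (a ∷ L)) (uncurry J) ≡ ∑[ y ∈ L ] J a y + ∑ (pairsL L) (uncurry J)
∑-pairsL-∷ a L J = trans (∑-++ (map (a ,_) L) (pairsL L) (uncurry J)) (cong (_+ ∑ (pairsL L) (uncurry J)) (∑-map L (a ,_) (uncurry J)))

∑-triplesL-∷ : (a : A) (L : List A) (K : A → A → A → ℚ) →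
               ∑ (triplesL (a ∷ L)) (uncurry₃ K) ≡ ∑ (pairsL L) (uncurry (K a)) + ∑ (triplesL L) (uncurry₃ K)
∑-triplesL-∷ a L K = trans (∑-++ (map (λ { (y , z) → a , y , z }) (pairsL L)) (triplesL L) (uncurry₃ K))
  (cong (_+ ∑ (triplesL L) (uncurry₃ K)) (∑-map (pairsL L) (λ { (y , z) → a , y , z }) (uncurry₃ K)))

∑²-∷ : (a : A) (L : List A) (G : A → A → ℚ) →
       ∑[ y ∈ a ∷ L ] ∑[ z ∈ a ∷ L ] G y z ≡ G a a + ∑[ z ∈ L ] G a z + ∑[ y ∈ L ] G y a + ∑[ y ∈ L ] ∑[ z ∈ L ] G y z
∑²-∷ a L G = trans (cong (G a a + ∑[ z ∈ L ] G a z +_) (∑-distrib-+ L (λ y → G y a) (λ y → ∑[ z ∈ L ] G y z)))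
  (assoc (G a a + ∑[ z ∈ L ] G a z) (∑[ y ∈ L ] G y a) (∑[ y ∈ L ] ∑[ z ∈ L ] G y z))
  where
  assoc : ∀ x y z → x + (y + z) ≡ x + y + z
  assoc = solve-∀ ℚ-ring

∑²-pairsL : (L : List A) (J : A → A → ℚ) → (∀ x y → J x y ≡ J y x) →
            ∑[ x ∈ L ] ∑[ y ∈ L ] J x y ≡ ∑[ x ∈ L ] J x x + (∑ (pairsL L) (uncurry J) + ∑ (pairsL L) (uncurry J))
∑²-pairsL []      J J-sym = refl
∑²-pairsL (a ∷ L) J J-sym = begin
  ∑[ x ∈ a ∷ L ] ∑[ y ∈ a ∷ L ] J x y
    ≡⟨ ∑²-∷ a L J ⟩
  J a a + R + ∑[ y ∈ L ] J y a + ∑[ x ∈ L ] ∑[ y ∈ L ] J x y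
    ≡⟨ cong₂ (λ u v → J a a + R + u + v) (∑-cong L (λ y → J-sym y a)) (∑²-pairsL L J J-sym) ⟩
  J a a + R + R + (∑[ x ∈ L ] J x x + (P + P))
    ≡⟨ regroup (J a a) R (∑[ x ∈ L ] J x x) P ⟩
  J a a + ∑[ x ∈ L ] J x x + ((R + P) + (R + P))
    ≡⟨ cong (λ q → J a a + ∑[ x ∈ L ] J x x + (q + q)) (∑-pairsL-∷ a L J) ⟨
  J a a + ∑[ x ∈ L ] J x x + (∑ (pairsL (a ∷ L)) (uncurry J) + ∑ (pairsL (a ∷ L)) (uncurry J)) ∎
  where
  open ≡-Reasoning
  R = ∑[ y ∈ L ] J a y
  P = ∑ (pairsL L) (uncurry J)
  regroup : ∀ d r s p → d + r + r + (s + (p + p)) ≡ d + s + ((r + p) + (r + p))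
  regroup = solve-∀ ℚ-ring

-- Of the ordered triples of positions, ℓ + 3ℓ(ℓ−1) repeat a position; the others are the 3! orderings of a 3-subset.
∑³-triplesL : (L : List A) (K : A → A → A → ℚ) (c : ℚ) →
              (∀ x y z → K x y z ≡ K y x z) → (∀ x y z → K x y z ≡ K x z y) → (∀ x z → K x x z ≡ c) →
              let ℓ = ℕ→ℚ (length L) in
              ∑[ x ∈ L ] ∑[ y ∈ L ] ∑[ z ∈ L ] K x y z ≡ c * (ℓ + ℕ→ℚ 3 * ℓ * (ℓ - 1ℚ)) + ℕ→ℚ 6 * ∑ (triplesL L) (uncurry₃ K)
∑³-triplesL [] K c _ _ _ = sym (empty c)
  where
  empty : ∀ c → c * (0ℚ + ℕ→ℚ 3 * 0ℚ * (0ℚ - 1ℚ)) + ℕ→ℚ 6 * 0ℚ ≡ 0ℚ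
  empty = solve-∀ ℚ-ring
∑³-triplesL (a ∷ L) K c K-swap₁₂ K-swap₂₃ K-diag = begin
  ∑[ y ∈ a ∷ L ] ∑[ z ∈ a ∷ L ] K a y z + ∑[ x ∈ L ] ∑[ y ∈ a ∷ L ] ∑[ z ∈ a ∷ L ] K x y z
    ≡⟨ cong₂ _+_ (∑²-∷ a L (K a)) (∑-cong L (λ x → ∑²-∷ a L (K x))) ⟩
  (K a a a + ∑[ z ∈ L ] K a a z + ∑[ y ∈ L ] K a y a + D)
    + ∑[ x ∈ L ] (K x a a + ∑[ z ∈ L ] K x a z + ∑[ y ∈ L ] K x y a + ∑[ y ∈ L ] ∑[ z ∈ L ] K x y z)
    ≡⟨ cong (K a a a + ∑[ z ∈ L ] K a a z + ∑[ y ∈ L ] K a y a + D +_) (∑-distrib-+₄ L _ _ _ _) ⟩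
  (K a a a + ∑[ z ∈ L ] K a a z + ∑[ y ∈ L ] K a y a + D)
    + (∑[ x ∈ L ] K x a a + ∑[ x ∈ L ] ∑[ z ∈ L ] K x a z + ∑[ x ∈ L ] ∑[ y ∈ L ] K x y a + ∑[ x ∈ L ] ∑[ y ∈ L ] ∑[ z ∈ L ] K x y z)
    ≡⟨ cong₂ _+_ (cong₂ _+_ (cong₂ _+_ (cong₂ _+_ (K-diag a a) (constant (λ z → K-diag a z))) (constant (λ y → trans (K-swap₂₃ a y a) (K-diag a y)))) D≡)
                 (cong₂ _+_ (cong₂ _+_ (cong₂ _+_ (constant (λ x → trans (K-swap₁₂ x a a) (trans (K-swap₂₃ a x a) (K-diag a x))))
                                                  (trans (∑-cong L (λ x → ∑-cong L (λ z → K-swap₁₂ x a z))) D≡))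
                                       (trans (∑-cong L (λ x → ∑-cong L (λ y → trans (K-swap₂₃ x y a) (K-swap₁₂ x a y)))) D≡))
                            (∑³-triplesL L K c K-swap₁₂ K-swap₂₃ K-diag)) ⟩
  (c + c * ℓ + c * ℓ + (c * ℓ + (P + P))) + (c * ℓ + (c * ℓ + (P + P)) + (c * ℓ + (P + P)) + (c * (ℓ + ℕ→ℚ 3 * ℓ * (ℓ - 1ℚ)) + ℕ→ℚ 6 * Tr))
    ≡⟨ regroup c ℓ P Tr ⟩
  c * ((1ℚ + ℓ) + ℕ→ℚ 3 * (1ℚ + ℓ) * ((1ℚ + ℓ) - 1ℚ)) + ℕ→ℚ 6 * (P + Tr)
    ≡⟨ cong₂ (λ m′ s → c * (m′ + ℕ→ℚ 3 * m′ * (m′ - 1ℚ)) + ℕ→ℚ 6 * s) (sym (ℕ→ℚ-+ 1 (length L))) (sym (∑-triplesL-∷ a L K)) ⟩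
  c * (ℕ→ℚ (length (a ∷ L)) + ℕ→ℚ 3 * ℕ→ℚ (length (a ∷ L)) * (ℕ→ℚ (length (a ∷ L)) - 1ℚ)) + ℕ→ℚ 6 * ∑ (triplesL (a ∷ L)) (uncurry₃ K) ∎
  where
  open ≡-Reasoning
  ℓ = ℕ→ℚ (length L)
  D = ∑[ y ∈ L ] ∑[ z ∈ L ] K a y z
  P = ∑ (pairsL L) (uncurry (K a))
  Tr = ∑ (triplesL L) (uncurry₃ K)
  constant : ∀ {f} → (∀ x → f x ≡ c) → ∑ L f ≡ c * ℓ
  constant f≡c = trans (∑-cong L f≡c) (∑-const L c)
  D≡ : D ≡ c * ℓ + (P + P)
  D≡ = trans (∑²-pairsL L (K a) (K-swap₂₃ a))
             (cong (_+ (P + P)) (constant (λ y → trans (K-swap₁₂ a y y) (trans (K-swap₂₃ y a y) (K-diag y a)))))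
  regroup : ∀ c ℓ P T →
    (c + c * ℓ + c * ℓ + (c * ℓ + (P + P))) + (c * ℓ + (c * ℓ + (P + P)) + (c * ℓ + (P + P)) + (c * (ℓ + ℕ→ℚ 3 * ℓ * (ℓ - 1ℚ)) + ℕ→ℚ 6 * T))
    ≡ c * ((1ℚ + ℓ) + ℕ→ℚ 3 * (1ℚ + ℓ) * ((1ℚ + ℓ) - 1ℚ)) + ℕ→ℚ 6 * (P + T)
  regroup = solve-∀ ℚ-ring

count-++ : (f : A → Bool) (L M : List A) → count f (L ++ M) ≡ count f L ℕ.+ count f M
count-++ f []      M = refl
count-++ f (x ∷ L) M = trans (cong ((if f x then 1 else 0) ℕ.+_) (count-++ f L M)) (sym (ℕ.+-assoc (if f x then 1 else 0) _ _))

count-map : {B : Set} (f : B → Bool) (g : A → B) (L : List A) → count f (map g L) ≡ count (λ x → f (g x)) L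
count-map f g []      = refl
count-map f g (x ∷ L) = cong ((if f (g x) then 1 else 0) ℕ.+_) (count-map f g L)

count-cong : {f g : A → Bool} (L : List A) → (∀ x → f x ≡ g x) → count f L ≡ count g L
count-cong []      f≗g = refl
count-cong (x ∷ L) f≗g = cong₂ (λ b k → (if b then 1 else 0) ℕ.+ k) (f≗g x) (count-cong L f≗g)

count-true : (L : List A) → count (λ _ → true) L ≡ length L
count-true []      = refl
count-true (x ∷ L) = cong suc (count-true L)

count-false : (L : List A) → count (λ _ → false) L ≡ 0
count-false []      = refl
count-false (x ∷ L) = count-false L

count-pairsL : (P : A → Bool) (L : List A) → count (λ t → P (proj₁ t) ∧ P (proj₂ t)) (pairsL L) ≡ count P L C 2
count-pairsL P []      = refl
count-pairsL P (x ∷ L) = begin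
  count (λ t → P (proj₁ t) ∧ P (proj₂ t)) (map (x ,_) L ++ pairsL L)
    ≡⟨ count-++ _ (map (x ,_) L) (pairsL L) ⟩
  count (λ t → P (proj₁ t) ∧ P (proj₂ t)) (map (x ,_) L) ℕ.+ count (λ t → P (proj₁ t) ∧ P (proj₂ t)) (pairsL L)
    ≡⟨ cong₂ ℕ._+_ (count-map _ (x ,_) L) (count-pairsL P L) ⟩
  count (λ y → P x ∧ P y) L ℕ.+ count P L C 2
    ≡⟨ pascal ⟩
  count P (x ∷ L) C 2 ∎
  where
  open ≡-Reasoning
  pascal : count (λ y → P x ∧ P y) L ℕ.+ count P L C 2 ≡ count P (x ∷ L) C 2
  pascal with P x
  ... | true  = trans (cong (ℕ._+ count P L C 2) (sym (nC1≡n (count P L)))) (nCk+nC[k+1]≡[n+1]C[k+1] (count P L) 1)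
  ... | false = cong (ℕ._+ count P L C 2) (count-false L)

count-triplesL : (P : A → Bool) (L : List A) →
                 count (λ t → P (proj₁ t) ∧ P (proj₁ (proj₂ t)) ∧ P (proj₂ (proj₂ t))) (triplesL L) ≡ count P L C 3
count-triplesL P []      = refl
count-triplesL P (x ∷ L) = begin
  count P₃ (map (λ { (y , z) → x , y , z }) (pairsL L) ++ triplesL L)
    ≡⟨ count-++ P₃ (map (λ { (y , z) → x , y , z }) (pairsL L)) (triplesL L) ⟩
  count P₃ (map (λ { (y , z) → x , y , z }) (pairsL L)) ℕ.+ count P₃ (triplesL L)
    ≡⟨ cong₂ ℕ._+_ (count-map P₃ (λ { (y , z) → x , y , z }) (pairsL L)) (count-triplesL P L) ⟩
  count (λ t → P x ∧ P (proj₁ t) ∧ P (proj₂ t)) (pairsL L) ℕ.+ count P L C 3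
    ≡⟨ pascal ⟩
  count P (x ∷ L) C 3 ∎
  where
  open ≡-Reasoning
  P₃ = λ t → P (proj₁ t) ∧ P (proj₁ (proj₂ t)) ∧ P (proj₂ (proj₂ t))
  pascal : count (λ t → P x ∧ P (proj₁ t) ∧ P (proj₂ t)) (pairsL L) ℕ.+ count P L C 3 ≡ count P (x ∷ L) C 3
  pascal with P x
  ... | true  = trans (cong (ℕ._+ count P L C 3) (count-pairsL P L)) (nCk+nC[k+1]≡[n+1]C[k+1] (count P L) 2)
  ... | false = cong (ℕ._+ count P L C 3) (count-false (pairsL L))

Distinct₃ : A × A × A → Set
Distinct₃ t = proj₁ t ≢ proj₁ (proj₂ t) × proj₁ (proj₂ t) ≢ proj₂ (proj₂ t) × proj₁ t ≢ proj₂ (proj₂ t)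

private
  pairsL-distinct : {L : List A} → AllPairs _≢_ L → All (λ t → proj₁ t ≢ proj₂ t) (pairsL L)
  pairsL-distinct []          = []
  pairsL-distinct (x∉ ∷ L!)   = All.++⁺ (All.map⁺ x∉) (pairsL-distinct L!)

  pairsL-avoid : {a : A} {L : List A} → All (a ≢_) L → All (λ t → a ≢ proj₁ t × a ≢ proj₂ t) (pairsL L)
  pairsL-avoid []            = []
  pairsL-avoid (a≢x ∷ a∉L)   = All.++⁺ (All.map⁺ (All.map (a≢x ,_) a∉L)) (pairsL-avoid a∉L)

triplesL-distinct : {L : List A} → AllPairs _≢_ L → All Distinct₃ (triplesL L)
triplesL-distinct []        = []
triplesL-distinct (a∉ ∷ L!) = All.++⁺
  (All.map⁺ (All.map (λ { ((a≢y , a≢z) , y≢z) → a≢y , y≢z , a≢z }) (All.zip (pairsL-avoid a∉ , pairsL-distinct L!))))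
  (triplesL-distinct L!)

-- Counting ordered triples of edges by shape

c2≡ : ∀ n → c2 n ≡ (ℕ→ℚ n - ℕ→ℚ 3) * (ℕ→ℚ n - ℕ→ℚ 4) * ½
c2≡ n = begin
  ((ℤ.+ n ℤ.- ℤ.+ 3) ℤ.* (ℤ.+ n ℤ.- ℤ.+ 4)) ℚ./ 2               ≡⟨ ℤ/2≡ℤ/1*½ ((ℤ.+ n ℤ.- ℤ.+ 3) ℤ.* (ℤ.+ n ℤ.- ℤ.+ 4)) ⟩
  ((ℤ.+ n ℤ.- ℤ.+ 3) ℤ.* (ℤ.+ n ℤ.- ℤ.+ 4)) ℚ./ 1 * ½           ≡⟨ cong (_* ½) (ℤ/1-* (ℤ.+ n ℤ.- ℤ.+ 3) (ℤ.+ n ℤ.- ℤ.+ 4)) ⟨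
  ((ℤ.+ n ℤ.- ℤ.+ 3) ℚ./ 1) * ((ℤ.+ n ℤ.- ℤ.+ 4) ℚ./ 1) * ½     ≡⟨ cong₂ (λ x y → x * y * ½) (ℤ/1-minus (ℤ.+ n) (ℤ.+ 3)) (ℤ/1-minus (ℤ.+ n) (ℤ.+ 4)) ⟨
  (ℕ→ℚ n - ℕ→ℚ 3) * (ℕ→ℚ n - ℕ→ℚ 4) * ½                ∎
  where open ≡-Reasoning

quadratic≡ : ∀ n a b → ((ℤ.+ n ℤ.* ℤ.+ n) ℤ.- (ℤ.+ a ℤ.* ℤ.+ n) ℤ.+ ℤ.+ b) ℚ./ 2 ≡ (ℕ→ℚ n * ℕ→ℚ n - ℕ→ℚ a * ℕ→ℚ n + ℕ→ℚ b) * ½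
quadratic≡ n a b = begin
  ((ℤ.+ n ℤ.* ℤ.+ n) ℤ.- (ℤ.+ a ℤ.* ℤ.+ n) ℤ.+ ℤ.+ b) ℚ./ 2          ≡⟨ ℤ/2≡ℤ/1*½ ((ℤ.+ n ℤ.* ℤ.+ n) ℤ.- (ℤ.+ a ℤ.* ℤ.+ n) ℤ.+ ℤ.+ b) ⟩
  ((ℤ.+ n ℤ.* ℤ.+ n) ℤ.- (ℤ.+ a ℤ.* ℤ.+ n) ℤ.+ ℤ.+ b) ℚ./ 1 * ½      ≡⟨ cong (_* ½) (ℤ/1-+ ((ℤ.+ n ℤ.* ℤ.+ n) ℤ.- (ℤ.+ a ℤ.* ℤ.+ n)) (ℤ.+ b)) ⟨
  (((ℤ.+ n ℤ.* ℤ.+ n) ℤ.- (ℤ.+ a ℤ.* ℤ.+ n)) ℚ./ 1 + ℕ→ℚ b) * ½   ≡⟨ cong (λ x → (x + ℕ→ℚ b) * ½) (ℤ/1-minus (ℤ.+ n ℤ.* ℤ.+ n) (ℤ.+ a ℤ.* ℤ.+ n)) ⟨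
  ((ℤ.+ n ℤ.* ℤ.+ n) ℚ./ 1 - (ℤ.+ a ℤ.* ℤ.+ n) ℚ./ 1 + ℕ→ℚ b) * ½ ≡⟨ cong₂ (λ x y → (x - y + ℕ→ℚ b) * ½) (ℤ/1-* (ℤ.+ n) (ℤ.+ n)) (ℤ/1-* (ℤ.+ a) (ℤ.+ n)) ⟨
  (ℕ→ℚ n * ℕ→ℚ n - ℕ→ℚ a * ℕ→ℚ n + ℕ→ℚ b) * ½            ∎
  where open ≡-Reasoning

tripleCoefficient : ℕ → Bool → ℕ → ℚ
tripleCoefficient n true  _ = c2 n
tripleCoefficient n false k = c2 n * 𝟙 (k ≡ᵇ 3) + c4 n * 𝟙 (k ≡ᵇ 4) + c32 n * 𝟙 (k ≡ᵇ 5) + c222 n * 𝟙 (k ≡ᵇ 6)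

characterValue : ℕ → ℕ → ℕ → ℚ
characterValue n m₁ m₂ = (F * F + (ℕ→ℚ n - ℕ→ℚ m₂) - ℕ→ℚ 4 * F) * ½
  where F = ℕ→ℚ n - ℕ→ℚ m₁

tripleCoefficient-in-n : ∀ n k → tripleCoefficient n false k ≡
  (ℕ→ℚ n - ℕ→ℚ 3) * (ℕ→ℚ n - ℕ→ℚ 4) * ½ * 𝟙 (k ≡ᵇ 3) + (ℕ→ℚ n * ℕ→ℚ n - ℕ→ℚ 11 * ℕ→ℚ n + ℕ→ℚ 28) * ½ * 𝟙 (k ≡ᵇ 4)
  + (ℕ→ℚ n * ℕ→ℚ n - ℕ→ℚ 13 * ℕ→ℚ n + ℕ→ℚ 42) * ½ * 𝟙 (k ≡ᵇ 5) + (ℕ→ℚ n * ℕ→ℚ n - ℕ→ℚ 15 * ℕ→ℚ n + ℕ→ℚ 60) * ½ * 𝟙 (k ≡ᵇ 6)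
tripleCoefficient-in-n n k = cong₂ _+_ (cong₂ _+_ (cong₂ _+_ (cong (_* 𝟙 (k ≡ᵇ 3)) (c2≡ n)) (cong (_* 𝟙 (k ≡ᵇ 4)) (quadratic≡ n 11 28)))
                                (cong (_* 𝟙 (k ≡ᵇ 5)) (quadratic≡ n 13 42)))
                     (cong (_* 𝟙 (k ≡ᵇ 6)) (quadratic≡ n 15 60))

χ-profile : ∀ {r k m₁ m₂ c} → Profile r k m₁ m₂ c → characterValue n m₁ m₂ ≡ tripleCoefficient n r k
χ-profile {n} repeatedEdge = trans (transposition (ℕ→ℚ n)) (sym (c2≡ n))
  where
  transposition : ∀ N → ((N - ℕ→ℚ 2) * (N - ℕ→ℚ 2) + (N - ℕ→ℚ 0) - ℕ→ℚ 4 * (N - ℕ→ℚ 2)) * ½ ≡ (N - ℕ→ℚ 3) * (N - ℕ→ℚ 4) * ½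
  transposition = solve-∀ ℚ-ring
χ-profile {n} triangle = trans (by-ring (ℕ→ℚ n)) (sym (tripleCoefficient-in-n n 3))
  where
  by-ring : ∀ N → ((N - ℕ→ℚ 2) * (N - ℕ→ℚ 2) + (N - ℕ→ℚ 0) - ℕ→ℚ 4 * (N - ℕ→ℚ 2)) * ½
                  ≡ (N - ℕ→ℚ 3) * (N - ℕ→ℚ 4) * ½ * 1ℚ + (N * N - ℕ→ℚ 11 * N + ℕ→ℚ 28) * ½ * 0ℚ
                    + (N * N - ℕ→ℚ 13 * N + ℕ→ℚ 42) * ½ * 0ℚ + (N * N - ℕ→ℚ 15 * N + ℕ→ℚ 60) * ½ * 0ℚ
  by-ring = solve-∀ ℚ-ring
χ-profile {n} (starOrPath _) = trans (by-ring (ℕ→ℚ n)) (sym (tripleCoefficient-in-n n 4))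
  where
  by-ring : ∀ N → ((N - ℕ→ℚ 4) * (N - ℕ→ℚ 4) + (N - ℕ→ℚ 4) - ℕ→ℚ 4 * (N - ℕ→ℚ 4)) * ½
                  ≡ (N - ℕ→ℚ 3) * (N - ℕ→ℚ 4) * ½ * 0ℚ + (N * N - ℕ→ℚ 11 * N + ℕ→ℚ 28) * ½ * 1ℚ
                    + (N * N - ℕ→ℚ 13 * N + ℕ→ℚ 42) * ½ * 0ℚ + (N * N - ℕ→ℚ 15 * N + ℕ→ℚ 60) * ½ * 0ℚ
  by-ring = solve-∀ ℚ-ring
χ-profile {n} pathAndEdge = trans (by-ring (ℕ→ℚ n)) (sym (tripleCoefficient-in-n n 5))
  where
  by-ring : ∀ N → ((N - ℕ→ℚ 5) * (N - ℕ→ℚ 5) + (N - ℕ→ℚ 3) - ℕ→ℚ 4 * (N - ℕ→ℚ 5)) * ½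
                  ≡ (N - ℕ→ℚ 3) * (N - ℕ→ℚ 4) * ½ * 0ℚ + (N * N - ℕ→ℚ 11 * N + ℕ→ℚ 28) * ½ * 0ℚ
                    + (N * N - ℕ→ℚ 13 * N + ℕ→ℚ 42) * ½ * 1ℚ + (N * N - ℕ→ℚ 15 * N + ℕ→ℚ 60) * ½ * 0ℚ
  by-ring = solve-∀ ℚ-ring
χ-profile {n} matching = trans (by-ring (ℕ→ℚ n)) (sym (tripleCoefficient-in-n n 6))
  where
  by-ring : ∀ N → ((N - ℕ→ℚ 6) * (N - ℕ→ℚ 6) + (N - ℕ→ℚ 0) - ℕ→ℚ 4 * (N - ℕ→ℚ 6)) * ½
                  ≡ (N - ℕ→ℚ 3) * (N - ℕ→ℚ 4) * ½ * 0ℚ + (N * N - ℕ→ℚ 11 * N + ℕ→ℚ 28) * ½ * 0ℚ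
                    + (N * N - ℕ→ℚ 13 * N + ℕ→ℚ 42) * ½ * 0ℚ + (N * N - ℕ→ℚ 15 * N + ℕ→ℚ 60) * ½ * 1ℚ
  by-ring = solve-∀ ℚ-ring

anyEqual : UPair n → UPair n → UPair n → Bool
anyEqual a b c = (a ≐ b) ∨ (b ≐ c) ∨ (a ≐ c)

repeated≡anyEqual : (a b c : UPair n) → ThreeSwaps.repeated (endpoints a b c) ≡ anyEqual a b c
repeated≡anyEqual a b c = cong₂ _∨_ (sameEdge≡≐ a b) (cong₂ _∨_ (sameEdge≡≐ b c) (sameEdge≡≐ a c))

private
  ∨-swap₁₂ : ∀ x y z → x ∨ (y ∨ z) ≡ y ∨ (x ∨ z)
  ∨-swap₁₂ x y z = trans (sym (∨-assoc x y z)) (trans (cong (_∨ z) (∨-comm x y)) (∨-assoc y x z))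

  ∨-swap₂₃ : ∀ x y z → x ∨ (y ∨ z) ≡ x ∨ (z ∨ y)
  ∨-swap₂₃ x y z = cong (x ∨_) (∨-comm y z)

anyEqual-swap₁₂ : (a b c : UPair n) → anyEqual a b c ≡ anyEqual b a c
anyEqual-swap₁₂ a b c = trans (cong (_∨ ((b ≐ c) ∨ (a ≐ c))) (≐-sym a b)) (∨-swap₂₃ (b ≐ a) (b ≐ c) (a ≐ c))

anyEqual-swap₂₃ : (a b c : UPair n) → anyEqual a b c ≡ anyEqual a c b
anyEqual-swap₂₃ a b c = begin
  (a ≐ b) ∨ (b ≐ c) ∨ (a ≐ c)   ≡⟨ ∨-swap₁₂ (a ≐ b) (b ≐ c) (a ≐ c) ⟩
  (b ≐ c) ∨ (a ≐ b) ∨ (a ≐ c)   ≡⟨ ∨-swap₂₃ (b ≐ c) (a ≐ b) (a ≐ c) ⟩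
  (b ≐ c) ∨ (a ≐ c) ∨ (a ≐ b)   ≡⟨ ∨-swap₁₂ (b ≐ c) (a ≐ c) (a ≐ b) ⟩
  (a ≐ c) ∨ (b ≐ c) ∨ (a ≐ b)   ≡⟨ cong (λ x → (a ≐ c) ∨ x ∨ (a ≐ b)) (≐-sym b c) ⟩
  (a ≐ c) ∨ (c ≐ b) ∨ (a ≐ b)   ∎
  where open ≡-Reasoning

unionSize-swap₁₂ : (a b c : UPair n) → unionSize (a , b , c) ≡ unionSize (b , a , c)
unionSize-swap₁₂ {n} a b c = count-cong (allFin n) (λ v → ∨-swap₁₂ (v ∈ᵖ a) (v ∈ᵖ b) (v ∈ᵖ c))

unionSize-swap₂₃ : (a b c : UPair n) → unionSize (a , b , c) ≡ unionSize (a , c , b)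
unionSize-swap₂₃ {n} a b c = count-cong (allFin n) (λ v → ∨-swap₂₃ (v ∈ᵖ a) (v ∈ᵖ b) (v ∈ᵖ c))

#fixed≡n-#moved : (σ σ′ : Fin n → Fin n) → (∀ v → σ′ v ≡ σ v) →
                  #fixed σ ≡ ℕ→ℚ n - ℕ→ℚ (count (λ v → not (σ′ v == v)) (allFin n))
#fixed≡n-#moved {n} σ σ′ σ′≗σ = begin
  #fixed σ                                          ≡⟨ by-ring (#fixed σ) (ℕ→ℚ n) ⟩
  ℕ→ℚ n - (ℕ→ℚ n - #fixed σ)                        ≡⟨ cong (λ x → ℕ→ℚ n - (x - #fixed σ)) (∑-allFin-1 n) ⟨
  ℕ→ℚ n - (∑[ _ ∈ V ] 1ℚ - #fixed σ)                ≡⟨ cong (ℕ→ℚ n -_) (∑-distrib-minus V (λ _ → 1ℚ) (λ v → 𝟙 (v == σ v))) ⟨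
  ℕ→ℚ n - ∑[ v ∈ V ] (1ℚ - 𝟙 (v == σ v))            ≡⟨ cong (ℕ→ℚ n -_) (∑-cong V moved) ⟩
  ℕ→ℚ n - ∑[ v ∈ V ] 𝟙 (not (σ′ v == v))            ≡⟨ cong (ℕ→ℚ n -_) (count≡∑𝟙 (λ v → not (σ′ v == v)) V) ⟨
  ℕ→ℚ n - ℕ→ℚ (count (λ v → not (σ′ v == v)) V)     ∎
  where
  open ≡-Reasoning
  V = allFin n
  by-ring : ∀ x N → x ≡ N - (N - x)
  by-ring = solve-∀ ℚ-ring
  moved : ∀ v → 1ℚ - 𝟙 (v == σ v) ≡ 𝟙 (not (σ′ v == v))
  moved v = trans (cong (λ b → 1ℚ - 𝟙 b) (trans (==-sym v (σ v)) (cong (_== v) (sym (σ′≗σ v))))) (sym (𝟙-not (σ′ v == v)))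

module _ {α γ : ℚ} (α-inv : α * (ℕ→ℚ n - ℕ→ℚ 2) ≡ 1ℚ) (γ-inv : γ * (ℕ→ℚ n - 1ℚ) ≡ 1ℚ) where
  open Projection {n} α γ

  χ-τ³ : (a b c : UPair n) → χ (τ³ a b c) ≡ tripleCoefficient n (anyEqual a b c) (unionSize (a , b , c))
  χ-τ³ a b c = begin
    χ σ
      ≡⟨ χ-fixedPoints α-inv γ-inv σ ⟩
    (#fixed σ * #fixed σ + #fixed (λ v → σ (σ v)) - ℕ→ℚ 4 * #fixed σ) * ½
      ≡⟨ cong₂ (λ x y → (x * x + y - ℕ→ℚ 4 * x) * ½)
               (#fixed≡n-#moved σ T.σ T.σ-unfold)
               (#fixed≡n-#moved (λ v → σ (σ v)) (λ v → T.σ (T.σ v)) (λ v → trans (T.σ-unfold (T.σ v)) (cong σ (T.σ-unfold v)))) ⟩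
    characterValue n T.#moved T.#moved²
      ≡⟨ χ-profile (triple-profile a b c) ⟩
    tripleCoefficient n T.repeated (unionSize (a , b , c))
      ≡⟨ cong (λ r → tripleCoefficient n r (unionSize (a , b , c))) (repeated≡anyEqual a b c) ⟩
    tripleCoefficient n (anyEqual a b c) (unionSize (a , b , c)) ∎
    where
    open ≡-Reasoning
    σ = τ³ a b c
    module T = ThreeSwaps (endpoints a b c)

private
  count≡0⇒All : {A : Set} (f : A → Bool) (L : List A) → count f L ≡ 0 → All (λ y → f y ≡ false) L
  count≡0⇒All f []      _ = []
  count≡0⇒All f (x ∷ L) c≡0 with f x in fx
  ... | false = fx ∷ count≡0⇒All f L c≡0

  count-≐≤1⇒Unique : (L : List (UPair n)) → (∀ q → count (_≐ q) L ℕ.≤ 1) → AllPairs _≢_ L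
  count-≐≤1⇒Unique []      _ = []
  count-≐≤1⇒Unique (a ∷ L) ≤1 = All.map avoid (count≡0⇒All (_≐ a) L none-in-L) ∷ count-≐≤1⇒Unique L rest
    where
    none-in-L : count (_≐ a) L ≡ 0
    none-in-L with ≤1 a
    ... | a-once rewrite ≐-refl a = ℕ.n≤0⇒n≡0 (ℕ.≤-pred a-once)
    avoid : ∀ {y} → (y ≐ a) ≡ false → a ≢ y
    avoid y≐a a≡y = contradiction (trans (sym (≐-refl a)) (subst (λ z → (z ≐ a) ≡ false) (sym a≡y) y≐a)) λ ()
    rest : ∀ q → count (_≐ q) L ℕ.≤ 1
    rest q = ℕ.≤-trans (ℕ.m≤n+m (count (_≐ q) L) _) (≤1 q)

allUPairs-unique : ∀ n → AllPairs _≢_ (allUPairs n)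
allUPairs-unique n = count-≐≤1⇒Unique (allUPairs n) (λ q → ℕ.≤-reflexive (ℕ→ℚ-injective (begin
  ℕ→ℚ (count (_≐ q) (allUPairs n))                ≡⟨ count≡∑𝟙 (_≐ q) (allUPairs n) ⟩
  ∑[ r ∈ allUPairs n ] 𝟙 (r ≐ q)                  ≡⟨ ∑-cong (allUPairs n) (λ r → sym (ℚ.*-identityʳ (𝟙 (r ≐ q)))) ⟩
  ∑[ r ∈ allUPairs n ] (𝟙 (r ≐ q) * 1ℚ)           ≡⟨ ∑-δ-upairs q (λ _ → 1ℚ) ⟩
  1ℚ                                              ∎)))
  where open ≡-Reasoning

edges-unique : (G : Graph n) → AllPairs _≢_ (edges G)
edges-unique {n} G = AllPairs.filter⁺ (λ p → G p Bool.≟ true) (allUPairs-unique n)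

anyEqual-distinct : {x y z : UPair n} → Distinct₃ (x , y , z) → anyEqual x y z ≡ false
anyEqual-distinct (x≢y , y≢z , x≢z) rewrite ≢⇒≐-false x≢y | ≢⇒≐-false y≢z | ≢⇒≐-false x≢z = refl

distinct-profile : {x y z : UPair n} → Distinct₃ (x , y , z) →
                   let open ThreeSwaps (endpoints x y z) in Profile false (unionSize (x , y , z)) #moved #moved² #common
distinct-profile {x = x} {y} {z} distinct =
  Profile-cong (trans (repeated≡anyEqual x y z) (anyEqual-distinct distinct)) refl refl refl refl (triple-profile x y z)

covers-3-to-6 : ∀ {k m₁ m₂ c} → Profile false k m₁ m₂ c → 𝟙 (k ≡ᵇ 3) + 𝟙 (k ≡ᵇ 4) + 𝟙 (k ≡ᵇ 5) + 𝟙 (k ≡ᵇ 6) ≡ 1ℚ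
covers-3-to-6 triangle       = refl
covers-3-to-6 (starOrPath _) = refl
covers-3-to-6 pathAndEdge    = refl
covers-3-to-6 matching       = refl

common-vertex-count : ∀ {k m₁ m₂ c} → Profile false k m₁ m₂ c → ℕ→ℚ c ≡ 𝟙 ((k ≡ᵇ 4) ∧ (0 <ᵇ c))
common-vertex-count triangle              = refl
common-vertex-count (starOrPath z≤n)      = refl
common-vertex-count (starOrPath (s≤s z≤n)) = refl
common-vertex-count pathAndEdge           = refl
common-vertex-count matching              = refl

rhs1-form : ∀ c₂ c₄ c₃₂ c₂₂₂ m t f q d →
  c₂ * (m + ℕ→ℚ 3 * m * (m - 1ℚ)) + ℕ→ℚ 6 * (c₂ * t + c₄ * f + c₃₂ * q + c₂₂₂ * d)
  ≡ c₂ * (m + ℕ→ℚ 3 * m * (m - 1ℚ) + ℕ→ℚ 6 * t) + ℕ→ℚ 6 * c₄ * f + ℕ→ℚ 6 * c₃₂ * q + ℕ→ℚ 6 * c₂₂₂ * d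
rhs1-form = solve-∀ ℚ-ring

rhs2-form : ∀ c₂ c₄ c₃₂ c₂₂₂ m t f q d →
  c₂ * (m + ℕ→ℚ 3 * m * (m - 1ℚ)) + ℕ→ℚ 6 * (c₂ * t + c₄ * f + c₃₂ * q + c₂₂₂ * d)
  ≡ c₂ * (m + ℕ→ℚ 3 * m * (m - 1ℚ) + ℕ→ℚ 6 * t) + ℕ→ℚ 6 * c₂₂₂ * (t + f + q + d) + ℕ→ℚ 6 * (c₄ - c₂₂₂) * f
    + ℕ→ℚ 6 * (c₃₂ - c₂₂₂) * q - ℕ→ℚ 6 * c₂₂₂ * t
rhs2-form = solve-∀ ℚ-ring

module _ (G : Graph n) where
  private
    E = edges G
    #E = ℕ→ℚ (numEdges G)

    K : UPair n → UPair n → UPair n → ℚ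
    K a b c = tripleCoefficient n (anyEqual a b c) (unionSize (a , b , c))

    K-swap₁₂ : ∀ a b c → K a b c ≡ K b a c
    K-swap₁₂ a b c = cong₂ (tripleCoefficient n) (anyEqual-swap₁₂ a b c) (unionSize-swap₁₂ a b c)

    K-swap₂₃ : ∀ a b c → K a b c ≡ K a c b
    K-swap₂₃ a b c = cong₂ (tripleCoefficient n) (anyEqual-swap₂₃ a b c) (unionSize-swap₂₃ a b c)

    K-diagonal : ∀ a c → K a a c ≡ c2 n
    K-diagonal a c rewrite ≐-refl a = refl

    distinct-triples : All Distinct₃ (triplesL E)
    distinct-triples = triplesL-distinct (edges-unique G)

  #shape : ℕ → ℚ
  #shape k = ℕ→ℚ (count (λ t → unionSize t ≡ᵇ k) (triplesL E))

  ∑³-tripleCoefficient : ∑[ x ∈ E ] ∑[ y ∈ E ] ∑[ z ∈ E ] K x y z ≡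
         c2 n * (#E + ℕ→ℚ 3 * #E * (#E - 1ℚ)) + ℕ→ℚ 6 * (c2 n * #shape 3 + c4 n * #shape 4 + c32 n * #shape 5 + c222 n * #shape 6)
  ∑³-tripleCoefficient = begin
    ∑[ x ∈ E ] ∑[ y ∈ E ] ∑[ z ∈ E ] K x y z
      ≡⟨ ∑³-triplesL E K (c2 n) K-swap₁₂ K-swap₂₃ K-diagonal ⟩
    c2 n * (#E′ + ℕ→ℚ 3 * #E′ * (#E′ - 1ℚ)) + ℕ→ℚ 6 * ∑ (triplesL E) (uncurry₃ K)
      ≡⟨ cong₂ (λ k s → c2 n * (k + ℕ→ℚ 3 * k * (k - 1ℚ)) + ℕ→ℚ 6 * s) (cong ℕ→ℚ (sym (count-true E))) by-shape ⟩
    c2 n * (#E + ℕ→ℚ 3 * #E * (#E - 1ℚ)) + ℕ→ℚ 6 * (c2 n * #shape 3 + c4 n * #shape 4 + c32 n * #shape 5 + c222 n * #shape 6) ∎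
    where
    open ≡-Reasoning
    #E′ = ℕ→ℚ (length E)
    S : ℕ → ℚ
    S k = ∑[ t ∈ triplesL E ] 𝟙 (unionSize t ≡ᵇ k)
    by-shape : ∑ (triplesL E) (uncurry₃ K) ≡ c2 n * #shape 3 + c4 n * #shape 4 + c32 n * #shape 5 + c222 n * #shape 6
    by-shape = begin
      ∑ (triplesL E) (uncurry₃ K)
        ≡⟨ ∑-cong-All distinct-triples (λ {t} d → cong (λ r → tripleCoefficient n r (unionSize t)) (anyEqual-distinct d)) ⟩
      ∑[ t ∈ triplesL E ] tripleCoefficient n false (unionSize t)
        ≡⟨ ∑-distrib-+₄ (triplesL E) _ _ _ _ ⟩
      ∑[ t ∈ triplesL E ] (c2 n * 𝟙 (unionSize t ≡ᵇ 3)) + ∑[ t ∈ triplesL E ] (c4 n * 𝟙 (unionSize t ≡ᵇ 4))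
        + ∑[ t ∈ triplesL E ] (c32 n * 𝟙 (unionSize t ≡ᵇ 5)) + ∑[ t ∈ triplesL E ] (c222 n * 𝟙 (unionSize t ≡ᵇ 6))
        ≡⟨ cong₂ _+_ (cong₂ _+_ (cong₂ _+_ (∑-*ˡ (triplesL E) (c2 n) _) (∑-*ˡ (triplesL E) (c4 n) _)) (∑-*ˡ (triplesL E) (c32 n) _))
                     (∑-*ˡ (triplesL E) (c222 n) _) ⟩
      c2 n * S 3 + c4 n * S 4 + c32 n * S 5 + c222 n * S 6
        ≡⟨ cong₂ _+_ (cong₂ _+_ (cong₂ _+_ (cong (c2 n *_) (shape 3)) (cong (c4 n *_) (shape 4))) (cong (c32 n *_) (shape 5)))
                     (cong (c222 n *_) (shape 6)) ⟩
      c2 n * #shape 3 + c4 n * #shape 4 + c32 n * #shape 5 + c222 n * #shape 6 ∎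
      where
      shape : ∀ k → S k ≡ #shape k
      shape k = sym (count≡∑𝟙 (λ t → unionSize t ≡ᵇ k) (triplesL E))

  choose-3 : ℕ→ℚ (numEdges G C 3) ≡ #shape 3 + #shape 4 + #shape 5 + #shape 6
  choose-3 = begin
    ℕ→ℚ (count (λ _ → true) E C 3)
      ≡⟨ cong ℕ→ℚ (count-triplesL (λ _ → true) E) ⟨
    ℕ→ℚ (count (λ _ → true) (triplesL E))
      ≡⟨ count≡∑𝟙 (λ _ → true) (triplesL E) ⟩
    ∑[ t ∈ triplesL E ] 1ℚ
      ≡⟨ ∑-cong-All distinct-triples (λ d → sym (covers-3-to-6 (distinct-profile d))) ⟩
    ∑[ t ∈ triplesL E ] (𝟙 (unionSize t ≡ᵇ 3) + 𝟙 (unionSize t ≡ᵇ 4) + 𝟙 (unionSize t ≡ᵇ 5) + 𝟙 (unionSize t ≡ᵇ 6))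
      ≡⟨ ∑-distrib-+₄ (triplesL E) _ _ _ _ ⟩
    ∑[ t ∈ triplesL E ] 𝟙 (unionSize t ≡ᵇ 3) + ∑[ t ∈ triplesL E ] 𝟙 (unionSize t ≡ᵇ 4)
      + ∑[ t ∈ triplesL E ] 𝟙 (unionSize t ≡ᵇ 5) + ∑[ t ∈ triplesL E ] 𝟙 (unionSize t ≡ᵇ 6)
      ≡⟨ cong₂ _+_ (cong₂ _+_ (cong₂ _+_ (shape 3) (shape 4)) (shape 5)) (shape 6) ⟩
    #shape 3 + #shape 4 + #shape 5 + #shape 6 ∎
    where
    open ≡-Reasoning
    shape : ∀ k → ∑[ t ∈ triplesL E ] 𝟙 (unionSize t ≡ᵇ k) ≡ #shape k
    shape k = sym (count≡∑𝟙 (λ t → unionSize t ≡ᵇ k) (triplesL E))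

  -- Σ_v C(d_v,3) counts pairs (v, t) with v common to the three edges of t; a common vertex forces a star.
  stars+paths : ℕ→ℚ (stars G ℕ.+ paths3 G) ≡ #shape 4
  stars+paths = begin
    ℕ→ℚ (stars G ℕ.+ paths3 G)
      ≡⟨ ℕ→ℚ-+ (stars G) (paths3 G) ⟩
    ℕ→ℚ (stars G) + ℕ→ℚ (paths3 G)
      ≡⟨ cong₂ _+_ stars≡ (count≡∑𝟙 (λ t → (unionSize t ≡ᵇ 4) ∧ not (commonVertex t)) (triplesL E)) ⟩
    ∑[ t ∈ triplesL E ] 𝟙 ((unionSize t ≡ᵇ 4) ∧ commonVertex t) + ∑[ t ∈ triplesL E ] 𝟙 ((unionSize t ≡ᵇ 4) ∧ not (commonVertex t))
      ≡⟨ ∑-distrib-+ (triplesL E) _ _ ⟨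
    ∑[ t ∈ triplesL E ] (𝟙 ((unionSize t ≡ᵇ 4) ∧ commonVertex t) + 𝟙 ((unionSize t ≡ᵇ 4) ∧ not (commonVertex t)))
      ≡⟨ ∑-cong (triplesL E) (λ t → split (unionSize t ≡ᵇ 4) (commonVertex t)) ⟩
    ∑[ t ∈ triplesL E ] 𝟙 (unionSize t ≡ᵇ 4)
      ≡⟨ count≡∑𝟙 (λ t → unionSize t ≡ᵇ 4) (triplesL E) ⟨
    #shape 4 ∎
    where
    open ≡-Reasoning
    split : ∀ b c → 𝟙 (b ∧ c) + 𝟙 (b ∧ not c) ≡ 𝟙 b
    split false _     = refl
    split true  true  = refl
    split true  false = refl
    common : UPair n × UPair n × UPair n → ℕ
    common t = count (λ v → (v ∈ᵖ proj₁ t) ∧ (v ∈ᵖ proj₁ (proj₂ t)) ∧ (v ∈ᵖ proj₂ (proj₂ t))) (allFin n)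
    stars≡ : ℕ→ℚ (stars G) ≡ ∑[ t ∈ triplesL E ] 𝟙 ((unionSize t ≡ᵇ 4) ∧ commonVertex t)
    stars≡ = begin
      ℕ→ℚ (stars G)
        ≡⟨ foldr+≡∑ (λ v → degree G v C 3) (allFin n) ⟩
      ∑[ v ∈ allFin n ] ℕ→ℚ (degree G v C 3)
        ≡⟨ ∑-cong (allFin n) (λ v → trans (cong ℕ→ℚ (sym (count-triplesL (v ∈ᵖ_) E))) (count≡∑𝟙 _ (triplesL E))) ⟩
      ∑[ v ∈ allFin n ] ∑[ t ∈ triplesL E ] 𝟙 ((v ∈ᵖ proj₁ t) ∧ (v ∈ᵖ proj₁ (proj₂ t)) ∧ (v ∈ᵖ proj₂ (proj₂ t)))
        ≡⟨ ∑-comm (allFin n) (triplesL E) _ ⟩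
      ∑[ t ∈ triplesL E ] ∑[ v ∈ allFin n ] 𝟙 ((v ∈ᵖ proj₁ t) ∧ (v ∈ᵖ proj₁ (proj₂ t)) ∧ (v ∈ᵖ proj₂ (proj₂ t)))
        ≡⟨ ∑-cong (triplesL E) (λ t → sym (count≡∑𝟙 _ (allFin n))) ⟩
      ∑[ t ∈ triplesL E ] ℕ→ℚ (common t)
        ≡⟨ ∑-cong-All distinct-triples (λ d → common-vertex-count (distinct-profile d)) ⟩
      ∑[ t ∈ triplesL E ] 𝟙 ((unionSize t ≡ᵇ 4) ∧ commonVertex t) ∎

  module _ {α γ : ℚ} (α-inv : α * (ℕ→ℚ n - ℕ→ℚ 2) ≡ 1ℚ) (γ-inv : γ * (ℕ→ℚ n - 1ℚ) ≡ 1ℚ) where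
    open Projection {n} α γ

    M3≡shapeSum : (P : Mat n) → IsOrthProjW P →
          M3 G P ≡ c2 n * (#E + ℕ→ℚ 3 * #E * (#E - 1ℚ)) + ℕ→ℚ 6 * (c2 n * #shape 3 + c4 n * #shape 4 + c32 n * #shape 5 + c222 n * #shape 6)
    M3≡shapeSum P P-proj = begin
      trace (P · X³)
        ≡⟨ ∑-cong (allUPairs n) (λ p → ∑-cong (allUPairs n) (λ r → cong (_* X³ r p) (orthProjW≡P₀ α-inv γ-inv P P-proj p r))) ⟩
      trace (P₀ · X³)
        ≡⟨ trace-P₀X³ G α γ ⟩
      ∑[ e₃ ∈ E ] ∑[ e₂ ∈ E ] ∑[ e₁ ∈ E ] χ (τ³ e₁ e₂ e₃)
        ≡⟨ ∑-cong E (λ e₃ → ∑-cong E (λ e₂ → ∑-cong E (λ e₁ →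
             trans (χ-τ³ {α = α} {γ} α-inv γ-inv e₁ e₂ e₃) (reverse e₁ e₂ e₃)))) ⟩
      ∑[ e₃ ∈ E ] ∑[ e₂ ∈ E ] ∑[ e₁ ∈ E ] K e₃ e₂ e₁
        ≡⟨ ∑³-tripleCoefficient ⟩
      c2 n * (#E + ℕ→ℚ 3 * #E * (#E - 1ℚ)) + ℕ→ℚ 6 * (c2 n * #shape 3 + c4 n * #shape 4 + c32 n * #shape 5 + c222 n * #shape 6) ∎
      where
      open ≡-Reasoning
      X³ = XG G · (XG G · XG G)
      reverse : ∀ a b c → K a b c ≡ K c b a
      reverse a b c = trans (K-swap₂₃ a b c) (trans (K-swap₁₂ a c b) (K-swap₂₃ c a b))

    M3≡rhs1 : (P : Mat n) → IsOrthProjW P → M3 G P ≡ rhs1 G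
    M3≡rhs1 P P-proj = begin
      M3 G P
        ≡⟨ M3≡shapeSum P P-proj ⟩
      c2 n * (#E + ℕ→ℚ 3 * #E * (#E - 1ℚ)) + ℕ→ℚ 6 * (c2 n * #shape 3 + c4 n * #shape 4 + c32 n * #shape 5 + c222 n * #shape 6)
        ≡⟨ rhs1-form (c2 n) (c4 n) (c32 n) (c222 n) #E (#shape 3) (#shape 4) (#shape 5) (#shape 6) ⟩
      c2 n * (#E + ℕ→ℚ 3 * #E * (#E - 1ℚ) + ℕ→ℚ 6 * #shape 3) + ℕ→ℚ 6 * c4 n * #shape 4 + ℕ→ℚ 6 * c32 n * #shape 5 + ℕ→ℚ 6 * c222 n * #shape 6
        ≡⟨ cong (λ f → c2 n * (#E + ℕ→ℚ 3 * #E * (#E - 1ℚ) + ℕ→ℚ 6 * #shape 3) + ℕ→ℚ 6 * c4 n * f + ℕ→ℚ 6 * c32 n * #shape 5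
                       + ℕ→ℚ 6 * c222 n * #shape 6) stars+paths ⟨
      rhs1 G ∎
      where open ≡-Reasoning

    M3≡rhs2 : (P : Mat n) → IsOrthProjW P → M3 G P ≡ rhs2 G
    M3≡rhs2 P P-proj = begin
      M3 G P
        ≡⟨ M3≡shapeSum P P-proj ⟩
      c2 n * (#E + ℕ→ℚ 3 * #E * (#E - 1ℚ)) + ℕ→ℚ 6 * (c2 n * #shape 3 + c4 n * #shape 4 + c32 n * #shape 5 + c222 n * #shape 6)
        ≡⟨ rhs2-form (c2 n) (c4 n) (c32 n) (c222 n) #E (#shape 3) (#shape 4) (#shape 5) (#shape 6) ⟩
      c2 n * (#E + ℕ→ℚ 3 * #E * (#E - 1ℚ) + ℕ→ℚ 6 * #shape 3) + ℕ→ℚ 6 * c222 n * (#shape 3 + #shape 4 + #shape 5 + #shape 6)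
        + ℕ→ℚ 6 * (c4 n - c222 n) * #shape 4 + ℕ→ℚ 6 * (c32 n - c222 n) * #shape 5 - ℕ→ℚ 6 * c222 n * #shape 3
        ≡⟨ cong₂ (λ C f → c2 n * (#E + ℕ→ℚ 3 * #E * (#E - 1ℚ) + ℕ→ℚ 6 * #shape 3) + ℕ→ℚ 6 * c222 n * C
                         + ℕ→ℚ 6 * (c4 n - c222 n) * f + ℕ→ℚ 6 * (c32 n - c222 n) * #shape 5 - ℕ→ℚ 6 * c222 n * #shape 3)
                 choose-3 stars+paths ⟨
      rhs2 G ∎
      where open ≡-Reasoning

projection-constants : ∀ k → ∃₂ λ α γ → α * (ℕ→ℚ (4 ℕ.+ k) - ℕ→ℚ 2) ≡ 1ℚ × γ * (ℕ→ℚ (4 ℕ.+ k) - 1ℚ) ≡ 1ℚ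
projection-constants k =
  α , γ , trans (cong (α *_) (ℕ→ℚ[a+b]-a≡b 2 (2 ℕ.+ k))) α-inv , trans (cong (γ *_) (ℕ→ℚ[a+b]-a≡b 1 (3 ℕ.+ k))) γ-inv
  where
  α = proj₁ (ℕ→ℚ-invertible (suc k))
  α-inv = proj₂ (ℕ→ℚ-invertible (suc k))
  γ = proj₁ (ℕ→ℚ-invertible (suc (suc k)))
  γ-inv = proj₂ (ℕ→ℚ-invertible (suc (suc k)))

mainTheorem10 : (n : ℕ) → 4 ≤ n → (G : Graph n) → (P : Mat n) → IsOrthProjW P →
    (M3 G P ≡ rhs1 G) × (M3 G P ≡ rhs2 G)
mainTheorem10 _ (s≤s (s≤s (s≤s (s≤s {n = k} z≤n)))) G P P-proj =
  let α , γ , α-inv , γ-inv = projection-constants k in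
  M3≡rhs1 G {α} {γ} α-inv γ-inv P P-proj , M3≡rhs2 G {α} {γ} α-inv γ-inv P P-proj
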